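{- Let $\Omega$ be a set of permutations. Then $$\mathcal{F}(\Omega)=\gamma\bigl(\mathrm{Modasc}[\Omega^{ -1}]\bigr),\qquad\text{where } [\Omega^{ -1}]=\bigcup_{\sigma\in\Omega}[\sigma^{ -1}],$$ and $\mathrm{Modasc}[\Omega^{ -1}]$ is the set of modified ascent sequences avoiding every element of $[\Omega^{ -1}]$, while $\mathcal{F}(\Omega)$ is the set of Fishburn permutations avoiding every element of $\Omega$.
   Context: A Cayley permutation of length $n\ge 0$ is a word $x=x(1)\cdots x(n)$ of positive integers in which every integer from $1$ to $\max(x)$ occurs; permutations (one-line notation) are the Cayley permutations without repeated letters; $\mathrm{id}_n=12\cdots n$, $\sigma^{ -1}$ is the inverse permutation. $x$ contains $y$ if some subsequence $x(i_1)\cdots x(i_k)$, $i_1<\cdots<i_k$, is order isomorphic to $y$ (same relative order and same equalities); otherwise $x$ avoids $y$. For a weakly increasing Cayley permutation $u$ and a Cayley permutation $v$ of the same length, the Burge transpose $(u,v)^T$ of the biword with columns $\binom{u(i)}{v(i)}$ is obtained by flipping each column and sorting the columns increasingly by top entry, ties broken by decreasing bottom entry. For $x$ of length $n$, $\gamma(x)$ is the bottom row of $(\mathrm{id}_n,x)^T$. Write $x\sim y$ iff $\gamma(x)=\gamma(y)$, and $[y]$ for the class of $y$. Modified ascent sequences $\mathrm{Modasc}$: the empty word and $1$ belong to it; for $n\ge2$, $x$ of length $n$ belongs iff either $x=va$ with $v\in\mathrm{Modasc}$ of length $n-1$ with last letter $b$ and $1\le a\le b$, or $x=\tilde v a$ with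 $v$ as before, $b<a\le2+\mathrm{asc}(v)$, $\mathrm{asc}(v)=|\{i: v(i)<v(i+1)\}|$, and $\tilde v$ obtained from $v$ by increasing every entry $c\ge a$ by one. A permutation $\pi$ is Fishburn if there are no indices $i$ and $k>i+1$ with $\pi(k)<\pi(i)<\pi(i+1)$ and $\pi(i)=\pi(k)+1$; $\mathcal F$ is the set of Fishburn permutations. It is known that $\gamma|_{\mathrm{Modasc}}$ is a length-preserving bijection $\mathrm{Modasc}\to\mathcal F$. -}

module Defs where

open import Data.Nat using (ℕ; zero; suc; _+_; _≤_; _<_; _⊔_; _<ᵇ_; _≡ᵇ_; _≤ᵇ_)
open import Data.Bool using (Bool; true; false; if_then_else_; _∨_; _∧_)
open import Data.List using (List; []; _∷_; _++_; [_]; map; length; zip; upTo; foldr)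
open import Data.List.Membership.Propositional using (_∈_)
open import Data.List.Relation.Unary.All using (All)
open import Data.List.Relation.Unary.Unique.Propositional using (Unique)
open import Data.List.Relation.Binary.Sublist.Propositional using (_⊆_)
open import Data.Maybe using (Maybe; just; nothing)
open import Data.Product using (Σ; ∃; _×_; _,_; proj₂)
open import Relation.Binary.PropositionalEquality using (_≡_)
open import Relation.Nullary using (¬_)
open import Function.Bundles using (_⇔_)

-- Words are lists of naturals; positions are 0-indexed.
at : List ℕ → ℕ → Maybe ℕ
at []       _       = nothing
at (a ∷ _)  zero    = just a
at (_ ∷ xs) (suc i) = at xs i

maxL : List ℕ → ℕ
maxL = foldr _⊔_ 0

IsCayley : List ℕ → Set
IsCayley x = All (λ a → 1 ≤ a) x × (∀ k → 1 ≤ k → k ≤ maxL x → k ∈ x)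

IsPerm : List ℕ → Set
IsPerm x = IsCayley x × Unique x

OrderIso : List ℕ → List ℕ → Set
OrderIso x y = length x ≡ length y ×
  (∀ i j a b c d → at x i ≡ just a → at x j ≡ just b →
     at y i ≡ just c → at y j ≡ just d →
     ((a < b) ⇔ (c < d)) × ((a ≡ b) ⇔ (c ≡ d)))

Contains : List ℕ → List ℕ → Set
Contains x y = ∃ λ z → z ⊆ x × OrderIso z y

Avoids : List ℕ → List ℕ → Set
Avoids x y = ¬ Contains x y

-- inverse permutation: σ⁻¹(k) = position (1-based) of k in σ
pos : ℕ → List ℕ → ℕ
pos k []       = 1
pos k (a ∷ xs) = if k ≡ᵇ a then 1 else suc (pos k xs)

inv : List ℕ → List ℕ
inv σ = map (λ i → pos (suc i) σ) (upTo (length σ))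

-- Burge transpose of a biword given as a list of columns (top , bottom):
-- flip each column, then sort increasingly by top, ties by decreasing bottom.
flipCol : ℕ × ℕ → ℕ × ℕ
flipCol (a , b) = (b , a)

before : ℕ × ℕ → ℕ × ℕ → Bool
before (a , b) (c , d) = (a <ᵇ c) ∨ ((a ≡ᵇ c) ∧ (d ≤ᵇ b))

insertCol : ℕ × ℕ → List (ℕ × ℕ) → List (ℕ × ℕ)
insertCol p []       = p ∷ []
insertCol p (q ∷ qs) = if before p q then p ∷ q ∷ qs else q ∷ insertCol p qs

sortCols : List (ℕ × ℕ) → List (ℕ × ℕ)
sortCols = foldr insertCol []

burgeT : List (ℕ × ℕ) → List (ℕ × ℕ)
burgeT cols = sortCols (map flipCol cols)

idW : ℕ → List ℕ
idW n = map suc (upTo n)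

-- γ(x) = bottom row of (id_n , x)^T
γ : List ℕ → List ℕ
γ x = map proj₂ (burgeT (zip (idW (length x)) x))

asc : List ℕ → ℕ
asc []             = 0
asc (a ∷ [])       = 0
asc (a ∷ b ∷ xs)   = (if a <ᵇ b then 1 else 0) + asc (b ∷ xs)

LastIs : List ℕ → ℕ → Set
LastIs v b = ∃ λ w → v ≡ w ++ [ b ]

bump : ℕ → List ℕ → List ℕ
bump a = map (λ c → if a ≤ᵇ c then suc c else c)

data Modasc : List ℕ → Set where
  mEmpty : Modasc []
  mOne   : Modasc [ 1 ]
  mStay  : ∀ {v b a} → Modasc v → LastIs v b → 1 ≤ a → a ≤ b → Modasc (v ++ [ a ])
  mJump  : ∀ {v b a} → Modasc v → LastIs v b → b < a → a ≤ 2 + asc v →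
           Modasc (bump a v ++ [ a ])

Fishburn : List ℕ → Set
Fishburn π = IsPerm π × ¬ (∃ λ i → ∃ λ k → ∃ λ a → ∃ λ b → ∃ λ c →
  (suc i < k) × at π i ≡ just a × at π (suc i) ≡ just b × at π k ≡ just c ×
  c < a × a < b × a ≡ suc c)

FishAvoid : (List ℕ → Set) → List ℕ → Set
FishAvoid Ω π = Fishburn π × (∀ σ → Ω σ → Avoids π σ)

InvClass : (List ℕ → Set) → List ℕ → Set
InvClass Ω z = ∃ λ σ → Ω σ × IsCayley z × γ z ≡ γ (inv σ)

ModascAvoid : (List ℕ → Set) → List ℕ → Set
ModascAvoid Ω y = Modasc y × (∀ z → InvClass Ω z → Avoids y z)

-- γ sorts the columns (x(i), i) of a word x by value, ties by decreasing position, and reads off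
-- the positions. Hence γ depends only on the pattern of a word, a pattern z of y yields the pattern
-- γ z of γ y, and conversely every permutation pattern σ of γ y is γ z for a Cayley pattern z of y.
-- Since γ (σ⁻¹) = σ, avoiding Ω on the Fishburn side is avoiding [Ω⁻¹] on the other side.
--
-- Appending an entry a to a
-- modified ascent sequence (after bumping, in a jump) inserts the new largest position n + 1 into γ
-- at the cut between the columns of value below a and the rest. In a modified ascent sequence the
-- ascent tops are exactly the first occurrences, so such an insertion never creates the Fishburn
-- pattern. Conversely, deleting n + 1 from a Fishburn permutation and inducting, the position of
-- n + 1 determines the entry to append.

module Submission where

open import Defs
open import Data.Bool using (Bool; true; false; if_then_else_; _∨_; _∧_; T)
open import Data.Bool.Properties using (T-∨; T-∧)
open import Data.Empty using (⊥; ⊥-elim)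
open import Data.List using (List; []; _∷_; _++_; [_]; map; length; zip; upTo; foldr; applyUpTo; filter)
open import Data.List using (initLast; _∷ʳ′_)
open import Data.List.Membership.Propositional using (_∈_; _∉_)
open import Data.List.Membership.Propositional.Properties using (∈-map⁻; ∈-map⁺; ∈-filter⁻; ∈-filter⁺)
open import Data.List.Membership.Propositional.Properties using (∈-++⁺ˡ; ∈-++⁺ʳ; ∈-++⁻; ∈-∃++)
open import Data.List.Properties using (length-++-sucʳ; ++-assoc; ++-conicalʳ; map-++; length-map; length-applyUpTo)
open import Data.List.Properties using (map-id; map-∘; map-cong-local; ∷-injective)
open import Data.Maybe using (just)
open import Data.Maybe.Properties using (just-injective)
open import Data.List.Relation.Unary.Any using (here; there)
open import Data.List.Relation.Unary.All as All using (All; []; _∷_)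
open import Data.List.Relation.Unary.AllPairs as AllPairs using (AllPairs; []; _∷_)
import Data.List.Relation.Unary.AllPairs.Properties as AllPairs
import Data.List.Relation.Unary.All.Properties as All
open import Data.List.Relation.Unary.Unique.Propositional using (Unique)
open import Data.List.Relation.Binary.Sublist.Propositional using (_⊆_; []; _∷_; _∷ʳ_; ⊆-refl; ⊆-antisym; minimum)
import Data.List.Relation.Binary.Sublist.Propositional.Properties as Sublist
open import Data.Nat using (ℕ; zero; suc; _+_; _⊔_; _≤_; _<_; _<?_; _<ᵇ_; _≡ᵇ_; _≤ᵇ_; z≤n; s≤s; s≤s⁻¹)
open import Data.Nat.Properties
open import Data.Product using (Σ; ∃; _×_; _,_; proj₁; proj₂)
import Data.Product as Product
open import Data.Product.Properties using (≡-dec)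
open import Data.List.Membership.DecPropositional _≟_ using (_∈?_)
open import Data.List.Membership.DecPropositional (≡-dec _≟_ _≟_) using () renaming (_∈?_ to _∈ᶜ?_)
open import Data.Sum using (_⊎_; inj₁; inj₂; [_,_]′)
open import Data.Unit using (tt)
open import Function using (_∘_)
open import Function.Bundles using (_⇔_; Equivalence; mk⇔)
open import Function.Properties.Equivalence using () renaming (sym to ⇔-sym; trans to ⇔-trans)
open import Relation.Binary.Definitions using (Asymmetric; tri<; tri≈; tri>)
open import Relation.Binary.PropositionalEquality using (_≡_; _≢_; refl; sym; trans; cong; cong₂; subst; subst₂)
open import Relation.Binary.PropositionalEquality using (module ≡-Reasoning)
open import Relation.Nullary using (¬_; Dec; yes; no)

-- Sorted lists

module _ {A : Set} {R : A → A → Set} (asym : Asymmetric R) where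

  ⊆-sorted : ∀ {xs ys} → AllPairs R xs → AllPairs R ys → (∀ {z} → z ∈ ys → z ∈ xs) → ys ⊆ xs
  ⊆-sorted {xs} {[]} _ _ _ = minimum xs
  ⊆-sorted {[]} {y ∷ ys} _ _ ys⊆xs with ys⊆xs (here refl)
  ... | ()
  ⊆-sorted {x ∷ xs} {y ∷ ys} (Rx ∷ sx) (Ry ∷ sy) ys⊆xs with ys⊆xs (here refl)
  ... | here refl = refl ∷ ⊆-sorted sx sy tail⊆
    where
    tail⊆ : ∀ {z} → z ∈ ys → z ∈ xs
    tail⊆ z∈ys with ys⊆xs (there z∈ys)
    ... | here refl = ⊥-elim (asym (All.lookup Ry z∈ys) (All.lookup Ry z∈ys))
    ... | there z∈xs = z∈xs
  ... | there y∈xs = x ∷ʳ ⊆-sorted sx (Ry ∷ sy) skip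
    where
    skip : ∀ {z} → z ∈ y ∷ ys → z ∈ xs
    skip z∈ with ys⊆xs z∈
    ... | there z∈xs = z∈xs
    ... | here refl with z∈
    ...   | here refl = ⊥-elim (asym (All.lookup Rx y∈xs) (All.lookup Rx y∈xs))
    ...   | there x∈ys = ⊥-elim (asym (All.lookup Rx y∈xs) (All.lookup Ry x∈ys))

  sorted-unique : ∀ {xs ys} → AllPairs R xs → AllPairs R ys →
    (∀ {z} → z ∈ xs → z ∈ ys) → (∀ {z} → z ∈ ys → z ∈ xs) → xs ≡ ys
  sorted-unique sx sy xs⊆ys ys⊆xs = ⊆-antisym (⊆-sorted sy sx xs⊆ys) (⊆-sorted sx sy ys⊆xs)

AllPairs-cases : ∀ {A : Set} {R : A → A → Set} {xs u v} → AllPairs R xs → u ∈ xs → v ∈ xs →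
  u ≡ v ⊎ R u v ⊎ R v u
AllPairs-cases (_ ∷ _) (here refl) (here refl) = inj₁ refl
AllPairs-cases (Rx ∷ _) (here refl) (there v∈) = inj₂ (inj₁ (All.lookup Rx v∈))
AllPairs-cases (Rx ∷ _) (there u∈) (here refl) = inj₂ (inj₂ (All.lookup Rx u∈))
AllPairs-cases (_ ∷ r) (there u∈) (there v∈) = AllPairs-cases r u∈ v∈

module _ {A : Set} {R : A → A → Set} where

  AllPairs-++⁻ˡ : ∀ xs {ys} → AllPairs R (xs ++ ys) → AllPairs R xs
  AllPairs-++⁻ˡ [] _ = []
  AllPairs-++⁻ˡ (x ∷ xs) (Rx ∷ rs) = All.tabulate (All.lookup Rx ∘ ∈-++⁺ˡ) ∷ AllPairs-++⁻ˡ xs rs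

  AllPairs-++⁻ʳ : ∀ xs {ys} → AllPairs R (xs ++ ys) → AllPairs R ys
  AllPairs-++⁻ʳ [] rs = rs
  AllPairs-++⁻ʳ (x ∷ xs) (_ ∷ rs) = AllPairs-++⁻ʳ xs rs

  AllPairs-++-between : ∀ xs {ys} → AllPairs R (xs ++ ys) → ∀ {p q} → p ∈ xs → q ∈ ys → R p q
  AllPairs-++-between (x ∷ xs) (Rx ∷ _) (here refl) q∈ = All.lookup Rx (∈-++⁺ʳ xs q∈)
  AllPairs-++-between (x ∷ xs) (_ ∷ rs) (there p∈) q∈ = AllPairs-++-between xs rs p∈ q∈

  AllPairs-to-last : ∀ xs {z ys} → AllPairs R ((xs ++ [ z ]) ++ ys) → ∀ {p} → p ∈ xs → R p z
  AllPairs-to-last xs {z} rs p∈ = AllPairs-++-between xs (AllPairs-++⁻ˡ (xs ++ [ z ]) rs) p∈ (here refl)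

AllPairs-resp-⊆ : ∀ {A : Set} {R : A → A → Set} {xs ys} → AllPairs R ys → xs ⊆ ys → AllPairs R xs
AllPairs-resp-⊆ [] [] = []
AllPairs-resp-⊆ (_ ∷ rs) (y ∷ʳ xs⊆) = AllPairs-resp-⊆ rs xs⊆
AllPairs-resp-⊆ (Ry ∷ rs) (refl ∷ xs⊆) = Sublist.All-resp-⊆ xs⊆ Ry ∷ AllPairs-resp-⊆ rs xs⊆

AllPairs-map-∈ : ∀ {A : Set} {R R′ : A → A → Set} {xs} → (∀ {p q} → p ∈ xs → q ∈ xs → R p q → R′ p q) →
  AllPairs R xs → AllPairs R′ xs
AllPairs-map-∈ f [] = []
AllPairs-map-∈ f (Rx ∷ rs) =
  All.tabulate (λ q∈ → f (here refl) (there q∈) (All.lookup Rx q∈)) ∷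
  AllPairs-map-∈ (λ p∈ q∈ → f (there p∈) (there q∈)) rs

map-++⁻ : ∀ {A B : Set} (f : A → B) (S : List A) (L R : List B) → map f S ≡ L ++ R →
  Σ (List A) λ S₁ → Σ (List A) λ S₂ → S ≡ S₁ ++ S₂ × map f S₁ ≡ L × map f S₂ ≡ R
map-++⁻ f S [] R fS≡ = [] , S , refl , refl , fS≡
map-++⁻ f (s ∷ S) (x ∷ L) R fS≡ with ∷-injective fS≡
... | fs≡x , fS≡′ with map-++⁻ f S L R fS≡′
...   | S₁ , S₂ , S≡ , fS₁≡ , fS₂≡ = s ∷ S₁ , S₂ , cong (s ∷_) S≡ , cong₂ _∷_ fs≡x fS₁≡ , fS₂≡

lift-⊆-map : ∀ {A B : Set} (f : A → B) (S : List A) {u} → u ⊆ map f S → Σ (List A) λ C → C ⊆ S × map f C ≡ u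
lift-⊆-map f [] [] = [] , [] , refl
lift-⊆-map f (s ∷ S) (_ ∷ʳ u⊆) with lift-⊆-map f S u⊆
... | C , C⊆ , refl = C , s ∷ʳ C⊆ , refl
lift-⊆-map f (s ∷ S) (refl ∷ u⊆) with lift-⊆-map f S u⊆
... | C , C⊆ , refl = s ∷ C , refl ∷ C⊆ , refl

at-∈ : ∀ (v : List ℕ) i {x} → at v i ≡ just x → x ∈ v
at-∈ (a ∷ v) zero refl = here refl
at-∈ (a ∷ v) (suc i) at≡ = there (at-∈ v i at≡)

∈-at : ∀ (v : List ℕ) {x} → x ∈ v → Σ ℕ λ i → at v i ≡ just x
∈-at (a ∷ v) (here refl) = 0 , refl
∈-at (a ∷ v) (there x∈) with ∈-at v x∈
... | i , at≡ = suc i , at≡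

at-<-length : ∀ (v : List ℕ) i {x} → at v i ≡ just x → i < length v
at-<-length (a ∷ v) zero _ = s≤s z≤n
at-<-length (a ∷ v) (suc i) at≡ = s≤s (at-<-length v i at≡)

at-defined : ∀ (x : List ℕ) i → i < length x → Σ ℕ λ a → at x i ≡ just a
at-defined (a ∷ x) zero _ = a , refl
at-defined (a ∷ x) (suc i) (s≤s i<) = at-defined x i i<

Unique-at-injective : ∀ (v : List ℕ) i j {a} → Unique v → at v i ≡ just a → at v j ≡ just a → i ≡ j
Unique-at-injective (x ∷ v) zero zero _ _ _ = refl
Unique-at-injective (x ∷ v) zero (suc j) (x∉ ∷ _) refl at-j = ⊥-elim (All.lookup x∉ (at-∈ v j at-j) refl)
Unique-at-injective (x ∷ v) (suc i) zero (x∉ ∷ _) at-i refl = ⊥-elim (All.lookup x∉ (at-∈ v i at-i) refl)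
Unique-at-injective (x ∷ v) (suc i) (suc j) (_ ∷ u) at-i at-j = cong suc (Unique-at-injective v i j u at-i at-j)

≤-maxL : ∀ (v : List ℕ) {x} → x ∈ v → x ≤ maxL v
≤-maxL (a ∷ v) (here refl) = m≤m⊔n a (maxL v)
≤-maxL (a ∷ v) (there x∈) = ≤-trans (≤-maxL v x∈) (m≤n⊔m a (maxL v))

maxL-≤ : ∀ (v : List ℕ) {b} → (∀ {x} → x ∈ v → x ≤ b) → maxL v ≤ b
maxL-≤ [] _ = z≤n
maxL-≤ (a ∷ v) bound = ⊔-lub (bound (here refl)) (maxL-≤ v (bound ∘ there))

maxL-∈ : ∀ (v : List ℕ) → v ≡ [] ⊎ maxL v ∈ v
maxL-∈ [] = inj₁ refl
maxL-∈ (a ∷ v) with ⊔-sel a (maxL v)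
... | inj₁ max≡a = inj₂ (subst (_∈ a ∷ v) (sym max≡a) (here refl))
... | inj₂ max≡ with maxL-∈ v
...   | inj₁ refl = inj₂ (subst (_∈ a ∷ []) (sym (⊔-identityʳ a)) (here refl))
...   | inj₂ max∈ = inj₂ (subst (_∈ a ∷ v) (sym max≡) (there max∈))

T-ext : ∀ {x y : Bool} → (T x → T y) → (T y → T x) → x ≡ y
T-ext {false} {false} _ _ = refl
T-ext {false} {true}  _ g = ⊥-elim (g tt)
T-ext {true}  {false} f _ = ⊥-elim (f tt)
T-ext {true}  {true}  _ _ = refl

T⇒≡true : ∀ {b} → T b → b ≡ true
T⇒≡true {true} _ = refl

¬T⇒≡false : ∀ {b} → ¬ T b → b ≡ false
¬T⇒≡false {false} _ = refl
¬T⇒≡false {true} ¬t = ⊥-elim (¬t tt)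

-- The column order and insertion sort

Column : Set
Column = ℕ × ℕ

Before : Column → Column → Set
Before p q = T (before p q)

Before⇔ : ∀ a b c d → Before (a , b) (c , d) ⇔ (a < c ⊎ a ≡ c × d ≤ b)
Before⇔ a b c d = mk⇔ to from
  where
  to : Before (a , b) (c , d) → a < c ⊎ a ≡ c × d ≤ b
  to h with Equivalence.to T-∨ h
  ... | inj₁ a<c = inj₁ (<ᵇ⇒< a c a<c)
  ... | inj₂ a≡c∧d≤b with Equivalence.to T-∧ a≡c∧d≤b
  ...   | a≡c , d≤b = inj₂ (≡ᵇ⇒≡ a c a≡c , ≤ᵇ⇒≤ d b d≤b)
  from : a < c ⊎ a ≡ c × d ≤ b → Before (a , b) (c , d)
  from (inj₁ a<c) = Equivalence.from T-∨ (inj₁ (<⇒<ᵇ a<c))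
  from (inj₂ (a≡c , d≤b)) = Equivalence.from T-∨ (inj₂ (Equivalence.from T-∧ (≡⇒≡ᵇ a c a≡c , ≤⇒≤ᵇ d≤b)))

Before⁻ : ∀ a b c d → Before (a , b) (c , d) → a < c ⊎ a ≡ c × d ≤ b
Before⁻ a b c d = Equivalence.to (Before⇔ a b c d)

Before⁺ : ∀ a b c d → a < c ⊎ a ≡ c × d ≤ b → Before (a , b) (c , d)
Before⁺ a b c d = Equivalence.from (Before⇔ a b c d)

Before-total : ∀ p q → ¬ Before p q → Before q p
Before-total (a , b) (c , d) ¬p≤q with <-cmp a c
... | tri< a<c _ _ = ⊥-elim (¬p≤q (Before⁺ a b c d (inj₁ a<c)))
... | tri> _ _ c<a = Before⁺ c d a b (inj₁ c<a)
... | tri≈ _ refl _ with ≤-total d b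
...   | inj₁ d≤b = ⊥-elim (¬p≤q (Before⁺ a b c d (inj₂ (refl , d≤b))))
...   | inj₂ b≤d = Before⁺ c d a b (inj₂ (refl , b≤d))

Before-trans : ∀ p q r → Before p q → Before q r → Before p r
Before-trans (a , b) (c , d) (e , f) p≤q q≤r with Before⁻ a b c d p≤q | Before⁻ c d e f q≤r
... | inj₁ a<c          | inj₁ c<e          = Before⁺ a b e f (inj₁ (<-trans a<c c<e))
... | inj₁ a<c          | inj₂ (refl , _)   = Before⁺ a b e f (inj₁ a<c)
... | inj₂ (refl , _)   | inj₁ c<e          = Before⁺ a b e f (inj₁ c<e)
... | inj₂ (refl , d≤b) | inj₂ (refl , f≤d) = Before⁺ a b e f (inj₂ (refl , ≤-trans f≤d d≤b))

Before-antisym : ∀ p q → Before p q → Before q p → p ≡ q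
Before-antisym (a , b) (c , d) p≤q q≤p with Before⁻ a b c d p≤q | Before⁻ c d a b q≤p
... | inj₁ a<c          | inj₁ c<a        = ⊥-elim (<-asym a<c c<a)
... | inj₁ a<c          | inj₂ (refl , _) = ⊥-elim (<-irrefl refl a<c)
... | inj₂ (refl , _)   | inj₁ c<a        = ⊥-elim (<-irrefl refl c<a)
... | inj₂ (refl , d≤b) | inj₂ (_ , b≤d) = cong (a ,_) (≤-antisym b≤d d≤b)

Before⇒≤ : ∀ p q → Before p q → proj₁ p ≤ proj₁ q
Before⇒≤ (a , b) (c , d) p≤q with Before⁻ a b c d p≤q
... | inj₁ a<c = <⇒≤ a<c
... | inj₂ (refl , _) = ≤-refl

_≺_ : Column → Column → Set
p ≺ q = Before p q × p ≢ q

≺-asym : Asymmetric _≺_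
≺-asym {p} {q} (p≤q , p≢q) (q≤p , _) = p≢q (Before-antisym p q p≤q q≤p)

Sorted : List Column → Set
Sorted = AllPairs _≺_

∈-insertCol⁻ : ∀ p S {e} → e ∈ insertCol p S → e ≡ p ⊎ e ∈ S
∈-insertCol⁻ p [] (here refl) = inj₁ refl
∈-insertCol⁻ p (q ∷ S) e∈ with before p q
∈-insertCol⁻ p (q ∷ S) (here refl) | true  = inj₁ refl
∈-insertCol⁻ p (q ∷ S) (there e∈)  | true  = inj₂ e∈
∈-insertCol⁻ p (q ∷ S) (here refl) | false = inj₂ (here refl)
∈-insertCol⁻ p (q ∷ S) (there e∈)  | false with ∈-insertCol⁻ p S e∈
... | inj₁ e≡p = inj₁ e≡p
... | inj₂ e∈S = inj₂ (there e∈S)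

∈-insertCol⁺ : ∀ p S {e} → e ≡ p ⊎ e ∈ S → e ∈ insertCol p S
∈-insertCol⁺ p [] (inj₁ refl) = here refl
∈-insertCol⁺ p (q ∷ S) e∈ with before p q
∈-insertCol⁺ p (q ∷ S) (inj₁ refl)        | true  = here refl
∈-insertCol⁺ p (q ∷ S) (inj₂ e∈)          | true  = there e∈
∈-insertCol⁺ p (q ∷ S) (inj₁ refl)        | false = there (∈-insertCol⁺ p S (inj₁ refl))
∈-insertCol⁺ p (q ∷ S) (inj₂ (here refl)) | false = here refl
∈-insertCol⁺ p (q ∷ S) (inj₂ (there e∈))  | false = there (∈-insertCol⁺ p S (inj₂ e∈))

∈-sortCols⁻ : ∀ C {e} → e ∈ sortCols C → e ∈ C
∈-sortCols⁻ (p ∷ C) e∈ with ∈-insertCol⁻ p (sortCols C) e∈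
... | inj₁ refl = here refl
... | inj₂ e∈′ = there (∈-sortCols⁻ C e∈′)

∈-sortCols⁺ : ∀ C {e} → e ∈ C → e ∈ sortCols C
∈-sortCols⁺ (p ∷ C) (here refl) = ∈-insertCol⁺ p (sortCols C) (inj₁ refl)
∈-sortCols⁺ (p ∷ C) (there e∈) = ∈-insertCol⁺ p (sortCols C) (inj₂ (∈-sortCols⁺ C e∈))

insertCol-sorted : ∀ p S → p ∉ S → Sorted S → Sorted (insertCol p S)
insertCol-sorted p [] _ _ = [] ∷ []
insertCol-sorted p (q ∷ S) p∉ (q≺S ∷ sS) with before p q in eq
... | true = All.tabulate p≺ ∷ q≺S ∷ sS
  where
  p≤q : Before p q
  p≤q = subst T (sym eq) tt
  p≺ : ∀ {x} → x ∈ q ∷ S → p ≺ x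
  p≺ (here refl) = p≤q , (λ p≡q → p∉ (here p≡q))
  p≺ {x} (there x∈S) =
    Before-trans p q x p≤q (proj₁ (All.lookup q≺S x∈S)) , λ { refl → p∉ (there x∈S) }
... | false = All.tabulate q≺ ∷ insertCol-sorted p S (λ p∈S → p∉ (there p∈S)) sS
  where
  q≺ : ∀ {x} → x ∈ insertCol p S → q ≺ x
  q≺ x∈ with ∈-insertCol⁻ p S x∈
  ... | inj₁ refl = Before-total p q (subst T eq) , (λ { refl → p∉ (here refl) })
  ... | inj₂ x∈S = All.lookup q≺S x∈S

sortCols-sorted : ∀ C → Unique C → Sorted (sortCols C)
sortCols-sorted [] _ = []
sortCols-sorted (p ∷ C) (p∉C ∷ uC) =
  insertCol-sorted p (sortCols C) (λ p∈ → All.lookup p∉C (∈-sortCols⁻ C p∈) refl) (sortCols-sorted C uC)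

length-insertCol : ∀ p S → length (insertCol p S) ≡ suc (length S)
length-insertCol p [] = refl
length-insertCol p (q ∷ S) with before p q
... | true = refl
... | false = cong suc (length-insertCol p S)

length-sortCols : ∀ C → length (sortCols C) ≡ length C
length-sortCols [] = refl
length-sortCols (p ∷ C) = trans (length-insertCol p (sortCols C)) (cong suc (length-sortCols C))

sortCols-unique : ∀ C S → Unique C → Sorted S → (∀ {e} → e ∈ S → e ∈ C) → (∀ {e} → e ∈ C → e ∈ S) →
  sortCols C ≡ S
sortCols-unique C S uC sS S⊆C C⊆S =
  sorted-unique ≺-asym (sortCols-sorted C uC) sS (C⊆S ∘ ∈-sortCols⁻ C) (∈-sortCols⁺ C ∘ S⊆C)

ColumnPair : Set
ColumnPair = Column × Column

insertByFst : ColumnPair → List ColumnPair → List ColumnPair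
insertByFst u [] = u ∷ []
insertByFst u (v ∷ vs) = if before (proj₁ u) (proj₁ v) then u ∷ v ∷ vs else v ∷ insertByFst u vs

sortByFst : List ColumnPair → List ColumnPair
sortByFst = foldr insertByFst []

∈-insertByFst⁻ : ∀ u L {e} → e ∈ insertByFst u L → e ≡ u ⊎ e ∈ L
∈-insertByFst⁻ u [] (here refl) = inj₁ refl
∈-insertByFst⁻ u (v ∷ L) e∈ with before (proj₁ u) (proj₁ v)
∈-insertByFst⁻ u (v ∷ L) (here refl) | true  = inj₁ refl
∈-insertByFst⁻ u (v ∷ L) (there e∈)  | true  = inj₂ e∈
∈-insertByFst⁻ u (v ∷ L) (here refl) | false = inj₂ (here refl)
∈-insertByFst⁻ u (v ∷ L) (there e∈)  | false with ∈-insertByFst⁻ u L e∈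
... | inj₁ e≡u = inj₁ e≡u
... | inj₂ e∈L = inj₂ (there e∈L)

∈-insertByFst⁺ : ∀ u L {e} → e ≡ u ⊎ e ∈ L → e ∈ insertByFst u L
∈-insertByFst⁺ u [] (inj₁ refl) = here refl
∈-insertByFst⁺ u (v ∷ L) e∈ with before (proj₁ u) (proj₁ v)
∈-insertByFst⁺ u (v ∷ L) (inj₁ refl)        | true  = here refl
∈-insertByFst⁺ u (v ∷ L) (inj₂ e∈)          | true  = there e∈
∈-insertByFst⁺ u (v ∷ L) (inj₁ refl)        | false = there (∈-insertByFst⁺ u L (inj₁ refl))
∈-insertByFst⁺ u (v ∷ L) (inj₂ (here refl)) | false = here refl
∈-insertByFst⁺ u (v ∷ L) (inj₂ (there e∈))  | false = there (∈-insertByFst⁺ u L (inj₂ e∈))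

∈-sortByFst⁻ : ∀ Z {e} → e ∈ sortByFst Z → e ∈ Z
∈-sortByFst⁻ (u ∷ Z) e∈ with ∈-insertByFst⁻ u (sortByFst Z) e∈
... | inj₁ refl = here refl
... | inj₂ e∈′ = there (∈-sortByFst⁻ Z e∈′)

∈-sortByFst⁺ : ∀ Z {e} → e ∈ Z → e ∈ sortByFst Z
∈-sortByFst⁺ (u ∷ Z) (here refl) = ∈-insertByFst⁺ u (sortByFst Z) (inj₁ refl)
∈-sortByFst⁺ (u ∷ Z) (there e∈) = ∈-insertByFst⁺ u (sortByFst Z) (inj₂ (∈-sortByFst⁺ Z e∈))

map-proj₁-sortByFst : ∀ Z → map proj₁ (sortByFst Z) ≡ sortCols (map proj₁ Z)
map-proj₁-sortByFst [] = refl
map-proj₁-sortByFst (u ∷ Z) =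
  trans (insert u (sortByFst Z)) (cong (insertCol (proj₁ u)) (map-proj₁-sortByFst Z))
  where
  insert : ∀ u L → map proj₁ (insertByFst u L) ≡ insertCol (proj₁ u) (map proj₁ L)
  insert u [] = refl
  insert u (v ∷ L) with before (proj₁ u) (proj₁ v)
  ... | true = refl
  ... | false = cong (proj₁ v ∷_) (insert u L)

SameOrder : List ColumnPair → Set
SameOrder Z = ∀ {u v} → u ∈ Z → v ∈ Z → before (proj₁ u) (proj₁ v) ≡ before (proj₂ u) (proj₂ v)

map-proj₂-sortByFst : ∀ Z → SameOrder Z → map proj₂ (sortByFst Z) ≡ sortCols (map proj₂ Z)
map-proj₂-sortByFst [] _ = refl
map-proj₂-sortByFst (u ∷ Z) same =
  trans (insert (sortByFst Z) (λ v∈ → same (here refl) (there (∈-sortByFst⁻ Z v∈))))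
        (cong (insertCol (proj₂ u)) (map-proj₂-sortByFst Z (λ v∈ w∈ → same (there v∈) (there w∈))))
  where
  insert : ∀ L → (∀ {v} → v ∈ L → before (proj₁ u) (proj₁ v) ≡ before (proj₂ u) (proj₂ v)) →
    map proj₂ (insertByFst u L) ≡ insertCol (proj₂ u) (map proj₂ L)
  insert [] _ = refl
  insert (v ∷ L) same-u rewrite same-u (here refl) with before (proj₂ u) (proj₂ v)
  ... | true = refl
  ... | false = cong (proj₂ v ∷_) (insert L (λ w∈ → same-u (there w∈)))

module _ {B : Set} (h : Column → B) where

  sortByFst-fst : ∀ Z → map (h ∘ proj₁) (sortByFst Z) ≡ map h (sortCols (map proj₁ Z))
  sortByFst-fst Z = trans (map-∘ (sortByFst Z)) (cong (map h) (map-proj₁-sortByFst Z))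

  sortByFst-snd : ∀ Z → SameOrder Z → map (h ∘ proj₂) (sortByFst Z) ≡ map h (sortCols (map proj₂ Z))
  sortByFst-snd Z same = trans (map-∘ (sortByFst Z)) (cong (map h) (map-proj₂-sortByFst Z same))

-- Columns of a word and order isomorphism

onValue : (ℕ → ℕ) → Column → Column
onValue f (c , p) = (f c , p)

columnsFrom : ℕ → List ℕ → List Column
columnsFrom k [] = []
columnsFrom k (x ∷ xs) = (x , k) ∷ columnsFrom (suc k) xs

sortedColumns : List ℕ → List Column
sortedColumns x = sortCols (columnsFrom 1 x)

γ≡sortedColumns : ∀ x → γ x ≡ map proj₂ (sortedColumns x)
γ≡sortedColumns x = cong (λ cols → map proj₂ (sortCols cols)) (flipped x (λ i → i) 0 (λ _ → refl))
  where
  flipped : ∀ (x : List ℕ) f k → (∀ i → f i ≡ k + i) →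
    map flipCol (zip (map suc (applyUpTo f (length x))) x) ≡ columnsFrom (suc k) x
  flipped [] f k f≗ = refl
  flipped (a ∷ x) f k f≗ rewrite f≗ 0 | +-identityʳ k =
    cong ((a , suc k) ∷_) (flipped x (f ∘ suc) (suc k) (λ i → trans (f≗ (suc i)) (+-suc k i)))

∈-columnsFrom⁻ : ∀ k v {e} → e ∈ columnsFrom k v → Σ ℕ λ i → proj₂ e ≡ k + i × at v i ≡ just (proj₁ e)
∈-columnsFrom⁻ k (a ∷ v) (here refl) = 0 , sym (+-identityʳ k) , refl
∈-columnsFrom⁻ k (a ∷ v) (there e∈) with ∈-columnsFrom⁻ (suc k) v e∈
... | i , e₂≡ , at≡ = suc i , trans e₂≡ (sym (+-suc k i)) , at≡

∈-columnsFrom⁺ : ∀ k v i {x} → at v i ≡ just x → (x , k + i) ∈ columnsFrom k v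
∈-columnsFrom⁺ k (a ∷ v) zero refl rewrite +-identityʳ k = here refl
∈-columnsFrom⁺ k (a ∷ v) (suc i) h rewrite +-suc k i = there (∈-columnsFrom⁺ (suc k) v i h)

columnsFrom-position≥ : ∀ k v {e} → e ∈ columnsFrom k v → k ≤ proj₂ e
columnsFrom-position≥ k v e∈ with ∈-columnsFrom⁻ k v e∈
... | i , refl , _ = m≤m+n k i

columnsFrom-position< : ∀ k v {e} → e ∈ columnsFrom k v → proj₂ e < k + length v
columnsFrom-position< k v e∈ with ∈-columnsFrom⁻ k v e∈
... | i , refl , at≡ = +-monoʳ-< k (at-<-length v i at≡)

columnsFrom-position-injective : ∀ k v {p q} → p ∈ columnsFrom k v → q ∈ columnsFrom k v →
  proj₂ p ≡ proj₂ q → p ≡ q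
columnsFrom-position-injective k v {x , _} p∈ q∈ refl with ∈-columnsFrom⁻ k v p∈ | ∈-columnsFrom⁻ k v q∈
... | i , i≡ , at-i | j , j≡ , at-j with +-cancelˡ-≡ k i j (trans (sym i≡) j≡)
... | refl with trans (sym at-i) at-j
... | refl = refl

IncreasingPositions : List Column → Set
IncreasingPositions = AllPairs (λ p q → proj₂ p < proj₂ q)

columnsFrom-increasing : ∀ k v → IncreasingPositions (columnsFrom k v)
columnsFrom-increasing k [] = []
columnsFrom-increasing k (a ∷ v) = All.tabulate (columnsFrom-position≥ (suc k) v) ∷ columnsFrom-increasing (suc k) v

columnsFrom-unique : ∀ k v → Unique (columnsFrom k v)
columnsFrom-unique k v = AllPairs.map (λ p<q p≡q → <-irrefl (cong proj₂ p≡q) p<q) (columnsFrom-increasing k v)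

sortedColumns-sorted : ∀ v → Sorted (sortedColumns v)
sortedColumns-sorted v = sortCols-sorted _ (columnsFrom-unique 1 v)

map-proj₁-columnsFrom : ∀ k y → map proj₁ (columnsFrom k y) ≡ y
map-proj₁-columnsFrom k [] = refl
map-proj₁-columnsFrom k (a ∷ y) = cong (a ∷_) (map-proj₁-columnsFrom (suc k) y)

length-columnsFrom : ∀ k y → length (columnsFrom k y) ≡ length y
length-columnsFrom k [] = refl
length-columnsFrom k (a ∷ y) = cong suc (length-columnsFrom (suc k) y)

columnsFrom-++ : ∀ k v a → columnsFrom k (v ++ [ a ]) ≡ columnsFrom k v ++ [ (a , k + length v) ]
columnsFrom-++ k [] a rewrite +-identityʳ k = refl
columnsFrom-++ k (b ∷ v) a rewrite columnsFrom-++ (suc k) v a | +-suc k (length v) = refl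

columnsFrom-map : ∀ k v (f : ℕ → ℕ) → columnsFrom k (map f v) ≡ map (onValue f) (columnsFrom k v)
columnsFrom-map k [] f = refl
columnsFrom-map k (a ∷ v) f = cong ((f a , k) ∷_) (columnsFrom-map (suc k) v f)

Agree : ℕ × ℕ → ℕ × ℕ → Set
Agree (a , c) (b , d) = ((a < b) ⇔ (c < d)) × ((a ≡ b) ⇔ (c ≡ d))

Agree-sym : ∀ {a b c d} → Agree (a , c) (b , d) → Agree (c , a) (d , b)
Agree-sym = Product.map ⇔-sym ⇔-sym

PositionwiseAgree : List ℕ → List ℕ → Set
PositionwiseAgree x y = ∀ i j a b c d → at x i ≡ just a → at x j ≡ just b →
  at y i ≡ just c → at y j ≡ just d → Agree (a , c) (b , d)

at-map₂ : ∀ {A : Set} (f g : A → ℕ) (L : List A) i {a c} → at (map f L) i ≡ just a → at (map g L) i ≡ just c →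
  Σ A λ u → u ∈ L × a ≡ f u × c ≡ g u
at-map₂ f g (u ∷ L) zero refl refl = u , here refl , refl , refl
at-map₂ f g (u ∷ L) (suc i) fu≡ gu≡ with at-map₂ f g L i fu≡ gu≡
... | v , v∈ , a≡ , c≡ = v , there v∈ , a≡ , c≡

OrderIso-map : ∀ {A : Set} (L : List A) (f g : A → ℕ) →
  (∀ {u v} → u ∈ L → v ∈ L → Agree (f u , g u) (f v , g v)) → OrderIso (map f L) (map g L)
OrderIso-map L f g agree = trans (length-map f L) (sym (length-map g L)) , positionwise
  where
  positionwise : PositionwiseAgree (map f L) (map g L)
  positionwise i j a b c d a≡ b≡ c≡ d≡ with at-map₂ f g L i a≡ c≡ | at-map₂ f g L j b≡ d≡
  ... | u , u∈ , refl , refl | v , v∈ , refl , refl = agree u∈ v∈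

at-resp-length : ∀ (x y : List ℕ) i {a} → length x ≡ length y → at x i ≡ just a → Σ ℕ λ c → at y i ≡ just c
at-resp-length (_ ∷ x) (c ∷ y) zero _ _ = c , refl
at-resp-length (_ ∷ x) (_ ∷ y) (suc i) len a≡ = at-resp-length x y i (suc-injective len) a≡

OrderIso-sym : ∀ {x y} → OrderIso x y → OrderIso y x
OrderIso-sym (len , agree) = sym len , λ i j a b c d a≡ b≡ c≡ d≡ → Agree-sym (agree i j c d a b c≡ d≡ a≡ b≡)

OrderIso-trans : ∀ {x y z} → OrderIso x y → OrderIso y z → OrderIso x z
OrderIso-trans {x} {y} {z} (len₁ , agree₁) (len₂ , agree₂) = trans len₁ len₂ , positionwise
  where
  positionwise : PositionwiseAgree x z
  positionwise i j a b c d a≡ b≡ c≡ d≡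
    with at-resp-length x y i len₁ a≡ | at-resp-length x y j len₁ b≡
  ... | p , p≡ | q , q≡ with agree₁ i j a b p q a≡ b≡ p≡ q≡ | agree₂ i j p q c d p≡ q≡ c≡ d≡
  ... | <₁ , ≡₁ | <₂ , ≡₂ = ⇔-trans <₁ <₂ , ⇔-trans ≡₁ ≡₂

before-resp-Agree : ∀ a b c d p q → Agree (a , c) (b , d) → before (a , p) (b , q) ≡ before (c , p) (d , q)
before-resp-Agree a b c d p q (a<b⇔c<d , a≡b⇔c≡d) = cong₂ _∨_
  (T-ext (λ t → <⇒<ᵇ (Equivalence.to a<b⇔c<d (<ᵇ⇒< a b t)))
         (λ t → <⇒<ᵇ (Equivalence.from a<b⇔c<d (<ᵇ⇒< c d t))))
  (cong (_∧ (q ≤ᵇ p))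
    (T-ext (λ t → ≡⇒≡ᵇ c d (Equivalence.to a≡b⇔c≡d (≡ᵇ⇒≡ a b t)))
           (λ t → ≡⇒≡ᵇ a b (Equivalence.from a≡b⇔c≡d (≡ᵇ⇒≡ c d t)))))

pairedColumns : ℕ → List ℕ → List ℕ → List ColumnPair
pairedColumns k w z = zip (columnsFrom k w) (columnsFrom k z)

∈-pairedColumns⁻ : ∀ k w z {u} → u ∈ pairedColumns k w z → Σ ℕ λ i → Σ ℕ λ a → Σ ℕ λ c →
  u ≡ ((a , k + i) , (c , k + i)) × at w i ≡ just a × at z i ≡ just c
∈-pairedColumns⁻ k (a ∷ w) (c ∷ z) (here refl) =
  0 , a , c , cong (λ s → ((a , s) , (c , s))) (sym (+-identityʳ k)) , refl , refl
∈-pairedColumns⁻ k (a ∷ w) (c ∷ z) (there u∈) with ∈-pairedColumns⁻ (suc k) w z u∈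
... | i , a′ , c′ , refl , a≡ , c≡ =
  suc i , a′ , c′ , cong (λ s → ((a′ , s) , (c′ , s))) (sym (+-suc k i)) , a≡ , c≡

∈-pairedColumns⁺ : ∀ k w z i {a c} → at w i ≡ just a → at z i ≡ just c →
  ((a , k + i) , (c , k + i)) ∈ pairedColumns k w z
∈-pairedColumns⁺ k (a ∷ w) (c ∷ z) zero refl refl rewrite +-identityʳ k = here refl
∈-pairedColumns⁺ k (_ ∷ w) (_ ∷ z) (suc i) a≡ c≡ rewrite +-suc k i =
  there (∈-pairedColumns⁺ (suc k) w z i a≡ c≡)

map-proj₁-pairedColumns : ∀ k w z → length w ≡ length z → map proj₁ (pairedColumns k w z) ≡ columnsFrom k w
map-proj₁-pairedColumns k [] [] _ = refl
map-proj₁-pairedColumns k (a ∷ w) (c ∷ z) len =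
  cong ((a , k) ∷_) (map-proj₁-pairedColumns (suc k) w z (suc-injective len))

map-proj₂-pairedColumns : ∀ k w z → length w ≡ length z → map proj₂ (pairedColumns k w z) ≡ columnsFrom k z
map-proj₂-pairedColumns k [] [] _ = refl
map-proj₂-pairedColumns k (a ∷ w) (c ∷ z) len =
  cong ((c , k) ∷_) (map-proj₂-pairedColumns (suc k) w z (suc-injective len))

pairedColumns-sameOrder : ∀ w z → OrderIso w z → SameOrder (pairedColumns 1 w z)
pairedColumns-sameOrder w z (_ , agree) u∈ v∈ with ∈-pairedColumns⁻ 1 w z u∈ | ∈-pairedColumns⁻ 1 w z v∈
... | i , a , c , refl , a≡ , c≡ | j , b , d , refl , b≡ , d≡ =
  before-resp-Agree a b c d (suc i) (suc j) (agree i j a b c d a≡ b≡ c≡ d≡)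

γ-resp-OrderIso : ∀ w z → OrderIso w z → γ w ≡ γ z
γ-resp-OrderIso w z iso@(len , _) = begin
  γ w                                              ≡⟨ γ≡sortedColumns w ⟩
  map proj₂ (sortCols (columnsFrom 1 w))           ≡⟨ cong (map proj₂ ∘ sortCols) (map-proj₁-pairedColumns 1 w z len) ⟨
  map proj₂ (sortCols (map proj₁ Z))               ≡⟨ sortByFst-fst proj₂ Z ⟨
  map (proj₂ ∘ proj₁) (sortByFst Z)                ≡⟨ map-cong-local (All.tabulate (samePosition ∘ ∈-sortByFst⁻ Z)) ⟩
  map (proj₂ ∘ proj₂) (sortByFst Z)                ≡⟨ sortByFst-snd proj₂ Z (pairedColumns-sameOrder w z iso) ⟩
  map proj₂ (sortCols (map proj₂ Z))               ≡⟨ cong (map proj₂ ∘ sortCols) (map-proj₂-pairedColumns 1 w z len) ⟩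
  map proj₂ (sortCols (columnsFrom 1 z))           ≡⟨ γ≡sortedColumns z ⟨
  γ z                                              ∎
  where
  open ≡-Reasoning
  Z : List ColumnPair
  Z = pairedColumns 1 w z
  samePosition : ∀ {u} → u ∈ Z → proj₂ (proj₁ u) ≡ proj₂ (proj₂ u)
  samePosition u∈ with ∈-pairedColumns⁻ 1 w z u∈
  ... | _ , _ , _ , refl , _ = refl

-- Patterns of a word and patterns of its image

renumbered : ℕ → List Column → List ColumnPair
renumbered k D = zip (columnsFrom k (map proj₁ D)) D

map-proj₁-renumbered : ∀ k D → map proj₁ (renumbered k D) ≡ columnsFrom k (map proj₁ D)
map-proj₁-renumbered k [] = refl
map-proj₁-renumbered k (d ∷ D) = cong ((proj₁ d , k) ∷_) (map-proj₁-renumbered (suc k) D)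

map-proj₂-renumbered : ∀ k D → map proj₂ (renumbered k D) ≡ D
map-proj₂-renumbered k [] = refl
map-proj₂-renumbered k (d ∷ D) = cong (d ∷_) (map-proj₂-renumbered (suc k) D)

renumbered-value : ∀ k D {u} → u ∈ renumbered k D → proj₁ (proj₁ u) ≡ proj₁ (proj₂ u)
renumbered-value k (d ∷ D) (here refl) = refl
renumbered-value k (d ∷ D) (there u∈) = renumbered-value (suc k) D u∈

BothIncreasing : ColumnPair → ColumnPair → Set
BothIncreasing u v = proj₂ (proj₁ u) < proj₂ (proj₁ v) × proj₂ (proj₂ u) < proj₂ (proj₂ v)

renumbered-increasing : ∀ k D → IncreasingPositions D → AllPairs BothIncreasing (renumbered k D)
renumbered-increasing k [] _ = []
renumbered-increasing k (d ∷ D) (d< ∷ inc) = All.tabulate below ∷ renumbered-increasing (suc k) D inc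
  where
  below : ∀ {v} → v ∈ renumbered (suc k) D → BothIncreasing ((proj₁ d , k) , d) v
  below {v} v∈ =
    columnsFrom-position≥ (suc k) (map proj₁ D)
      (subst (proj₁ v ∈_) (map-proj₁-renumbered (suc k) D) (∈-map⁺ proj₁ v∈)) ,
    All.lookup d< (subst (proj₂ v ∈_) (map-proj₂-renumbered (suc k) D) (∈-map⁺ proj₂ v∈))

positions-agree : ∀ {Z u v} → AllPairs BothIncreasing Z → u ∈ Z → v ∈ Z →
  Agree (proj₂ (proj₁ u) , proj₂ (proj₂ u)) (proj₂ (proj₁ v) , proj₂ (proj₂ v))
positions-agree inc u∈ v∈ with AllPairs-cases inc u∈ v∈
... | inj₁ refl = mk⇔ (λ i<i → ⊥-elim (<-irrefl refl i<i)) (λ p<p → ⊥-elim (<-irrefl refl p<p)) ,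
                  mk⇔ (λ _ → refl) (λ _ → refl)
... | inj₂ (inj₁ (i<j , p<q)) = mk⇔ (λ _ → p<q) (λ _ → i<j) ,
                                mk⇔ (λ i≡j → ⊥-elim (<-irrefl i≡j i<j)) (λ p≡q → ⊥-elim (<-irrefl p≡q p<q))
... | inj₂ (inj₂ (j<i , q<p)) = mk⇔ (λ i<j → ⊥-elim (<-asym i<j j<i)) (λ p<q → ⊥-elim (<-asym p<q q<p)) ,
                                mk⇔ (λ i≡j → ⊥-elim (<-irrefl (sym i≡j) j<i)) (λ p≡q → ⊥-elim (<-irrefl (sym p≡q) q<p))

before-resp-position : ∀ a b i j p q → (i < j) ⇔ (p < q) → before (a , i) (b , j) ≡ before (a , p) (b , q)
before-resp-position a b i j p q i<j⇔p<q = cong (λ t → (a <ᵇ b) ∨ ((a ≡ᵇ b) ∧ t))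
  (T-ext (λ t → ≤⇒≤ᵇ (≮⇒≥ (λ p<q → <⇒≱ (Equivalence.from i<j⇔p<q p<q) (≤ᵇ⇒≤ j i t))))
         (λ t → ≤⇒≤ᵇ (≮⇒≥ (λ i<j → <⇒≱ (Equivalence.to i<j⇔p<q i<j) (≤ᵇ⇒≤ q p t)))))

renumbered-sameOrder : ∀ k D → IncreasingPositions D → SameOrder (renumbered k D)
renumbered-sameOrder k D inc {(a , i) , (a′ , p)} {(b , j) , (b′ , q)} u∈ v∈
  with renumbered-value k D u∈ | renumbered-value k D v∈
... | refl | refl = before-resp-position a b i j p q (proj₁ (positions-agree (renumbered-increasing k D inc) u∈ v∈))

module _ (y : List ℕ) (D : List Column) (D⊆ : D ⊆ columnsFrom 1 y) where

  sortCols-sublist-⊆-γ : map proj₂ (sortCols D) ⊆ γ y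
  sortCols-sublist-⊆-γ = subst (map proj₂ (sortCols D) ⊆_) (sym (γ≡sortedColumns y))
    (Sublist.map⁺ proj₂ (⊆-sorted ≺-asym (sortedColumns-sorted y)
      (sortCols-sorted D (AllPairs-resp-⊆ (columnsFrom-unique 1 y) D⊆))
      (λ e∈ → ∈-sortCols⁺ (columnsFrom 1 y) (Sublist.Any-resp-⊆ D⊆ (∈-sortCols⁻ D e∈)))))

  sortCols-sublist-OrderIso : OrderIso (map proj₂ (sortCols D)) (γ (map proj₁ D))
  sortCols-sublist-OrderIso =
    subst₂ OrderIso (sym positionsInY) (sym positionsInPattern)
      (OrderIso-map L (proj₂ ∘ proj₂) (proj₂ ∘ proj₁)
        (λ u∈ v∈ → Agree-sym (positions-agree bothIncreasing (∈-sortByFst⁻ Z u∈) (∈-sortByFst⁻ Z v∈))))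
    where
    open ≡-Reasoning
    increasing : IncreasingPositions D
    increasing = AllPairs-resp-⊆ (columnsFrom-increasing 1 y) D⊆
    bothIncreasing : AllPairs BothIncreasing (renumbered 1 D)
    bothIncreasing = renumbered-increasing 1 D increasing
    Z : List ColumnPair
    Z = renumbered 1 D
    L : List ColumnPair
    L = sortByFst Z
    positionsInY : map proj₂ (sortCols D) ≡ map (proj₂ ∘ proj₂) L
    positionsInY = begin
      map proj₂ (sortCols D)             ≡⟨ cong (map proj₂ ∘ sortCols) (map-proj₂-renumbered 1 D) ⟨
      map proj₂ (sortCols (map proj₂ Z)) ≡⟨ sortByFst-snd proj₂ Z (renumbered-sameOrder 1 D increasing) ⟨
      map (proj₂ ∘ proj₂) L              ∎
    positionsInPattern : γ (map proj₁ D) ≡ map (proj₂ ∘ proj₁) L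
    positionsInPattern = begin
      γ (map proj₁ D)                                ≡⟨ γ≡sortedColumns (map proj₁ D) ⟩
      map proj₂ (sortCols (columnsFrom 1 (map proj₁ D))) ≡⟨ cong (map proj₂ ∘ sortCols) (map-proj₁-renumbered 1 D) ⟨
      map proj₂ (sortCols (map proj₁ Z))             ≡⟨ sortByFst-fst proj₂ Z ⟨
      map (proj₂ ∘ proj₁) L                          ∎

Contains-γ : ∀ y z → Contains y z → Contains (γ y) (γ z)
Contains-γ y z (w , w⊆y , w≅z)
  with lift-⊆-map proj₁ (columnsFrom 1 y) (subst (w ⊆_) (sym (map-proj₁-columnsFrom 1 y)) w⊆y)
... | D , D⊆ , refl =
  map proj₂ (sortCols D) , sortCols-sublist-⊆-γ y D D⊆ ,
  subst (OrderIso (map proj₂ (sortCols D))) (γ-resp-OrderIso (map proj₁ D) z w≅z) (sortCols-sublist-OrderIso y D D⊆)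

-- Permutations

upFrom : ℕ → ℕ → List ℕ
upFrom k zero = []
upFrom k (suc n) = k ∷ upFrom (suc k) n

length-upFrom : ∀ k n → length (upFrom k n) ≡ n
length-upFrom k zero = refl
length-upFrom k (suc n) = cong suc (length-upFrom (suc k) n)

∈-upFrom⁻ : ∀ k n {e} → e ∈ upFrom k n → k ≤ e × e < k + n
∈-upFrom⁻ k (suc n) (here refl) = ≤-refl , m<m+n k (s≤s z≤n)
∈-upFrom⁻ k (suc n) {e} (there e∈) with ∈-upFrom⁻ (suc k) n e∈
... | k<e , e< = <⇒≤ k<e , subst (e <_) (sym (+-suc k n)) e<

∈-upFrom⁺ : ∀ k n {e} → k ≤ e → e < k + n → e ∈ upFrom k n
∈-upFrom⁺ k zero {e} k≤e e< = ⊥-elim (<-irrefl refl (≤-<-trans k≤e (subst (e <_) (+-identityʳ k) e<)))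
∈-upFrom⁺ k (suc n) {e} k≤e e< with k ≟ e
... | yes refl = here refl
... | no k≢e = there (∈-upFrom⁺ (suc k) n (≤∧≢⇒< k≤e k≢e) (subst (e <_) (+-suc k n) e<))

upFrom-increasing : ∀ k n → AllPairs _<_ (upFrom k n)
upFrom-increasing k zero = []
upFrom-increasing k (suc n) =
  All.tabulate (λ e∈ → proj₁ (∈-upFrom⁻ (suc k) n e∈)) ∷ upFrom-increasing (suc k) n

length-sortedColumns : ∀ w → length (sortedColumns w) ≡ length w
length-sortedColumns w = trans (length-sortCols (columnsFrom 1 w)) (length-columnsFrom 1 w)

∈-sortedColumns⁻ : ∀ v {p} → p ∈ sortedColumns v → Σ ℕ λ i → proj₂ p ≡ suc i × at v i ≡ just (proj₁ p)
∈-sortedColumns⁻ v p∈ = ∈-columnsFrom⁻ 1 v (∈-sortCols⁻ _ p∈)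

∈-sortedColumns⁺ : ∀ v i {x} → at v i ≡ just x → (x , suc i) ∈ sortedColumns v
∈-sortedColumns⁺ v i at≡ = ∈-sortCols⁺ _ (∈-columnsFrom⁺ 1 v i at≡)

sortedColumns-value-∈ : ∀ v {p} → p ∈ sortedColumns v → proj₁ p ∈ v
sortedColumns-value-∈ v p∈ with ∈-sortedColumns⁻ v p∈
... | i , _ , at≡ = at-∈ v i at≡

sortedValues-increasing : ∀ w → Unique w → AllPairs _<_ (map proj₁ (sortedColumns w))
sortedValues-increasing w u = AllPairs.map⁺ (AllPairs-map-∈ value< (sortedColumns-sorted w))
  where
  value< : ∀ {p q} → p ∈ sortedColumns w → q ∈ sortedColumns w → p ≺ q → proj₁ p < proj₁ q
  value< {a , i} {c , j} p∈ q∈ (p≤q , p≢q) with Before⁻ a i c j p≤q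
  ... | inj₁ a<c = a<c
  ... | inj₂ (refl , _) with ∈-sortedColumns⁻ w p∈ | ∈-sortedColumns⁻ w q∈
  ...   | i′ , refl , at-i | j′ , refl , at-j with Unique-at-injective w i′ j′ u at-i at-j
  ...     | refl = ⊥-elim (p≢q refl)

sortedValues-perm : ∀ w → IsPerm w → map proj₁ (sortedColumns w) ≡ upFrom 1 (maxL w)
sortedValues-perm w ((positive , covers) , u) =
  sorted-unique <-asym (sortedValues-increasing w u) (upFrom-increasing 1 (maxL w)) ⊆range range⊆
  where
  range⊆ : ∀ {e} → e ∈ upFrom 1 (maxL w) → e ∈ map proj₁ (sortedColumns w)
  range⊆ e∈ with ∈-upFrom⁻ 1 (maxL w) e∈
  ... | 1≤e , e≤ with ∈-at w (covers _ 1≤e (s≤s⁻¹ e≤))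
  ...   | i , at≡ = ∈-map⁺ proj₁ (∈-sortedColumns⁺ w i at≡)
  ⊆range : ∀ {e} → e ∈ map proj₁ (sortedColumns w) → e ∈ upFrom 1 (maxL w)
  ⊆range e∈ with ∈-map⁻ proj₁ e∈
  ... | p , p∈ , refl = let p∈w = sortedColumns-value-∈ w p∈ in
    ∈-upFrom⁺ 1 (maxL w) (All.lookup positive p∈w) (s≤s (≤-maxL w p∈w))

maxL-perm : ∀ w → IsPerm w → maxL w ≡ length w
maxL-perm w perm = begin
  maxL w                                ≡⟨ length-upFrom 1 (maxL w) ⟨
  length (upFrom 1 (maxL w))            ≡⟨ cong length (sortedValues-perm w perm) ⟨
  length (map proj₁ (sortedColumns w))  ≡⟨ length-map proj₁ (sortedColumns w) ⟩
  length (sortedColumns w)              ≡⟨ length-sortedColumns w ⟩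
  length w                              ∎
  where open ≡-Reasoning

γ-length : ∀ x → length (γ x) ≡ length x
γ-length x =
  trans (cong length (γ≡sortedColumns x)) (trans (length-map proj₂ (sortedColumns x)) (length-sortedColumns x))

∈-γ⁻ : ∀ x {e} → e ∈ γ x → 1 ≤ e × e ≤ length x
∈-γ⁻ x e∈ with ∈-map⁻ proj₂ (subst (_ ∈_) (γ≡sortedColumns x) e∈)
... | p , p∈ , refl with ∈-sortedColumns⁻ x p∈
... | i , refl , at≡ = s≤s z≤n , at-<-length x i at≡

∈-γ⁺ : ∀ x {e} → 1 ≤ e → e ≤ length x → e ∈ γ x
∈-γ⁺ x {suc i} _ i< with at-defined x i i<
... | a , at≡ = subst (suc i ∈_) (sym (γ≡sortedColumns x)) (∈-map⁺ proj₂ (∈-sortedColumns⁺ x i at≡))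

γ-IsPerm : ∀ x → IsPerm (γ x)
γ-IsPerm x =
  (All.tabulate (proj₁ ∘ ∈-γ⁻ x) ,
   λ k 1≤k k≤ → ∈-γ⁺ x 1≤k (≤-trans k≤ (maxL-≤ (γ x) (proj₂ ∘ ∈-γ⁻ x)))) ,
  subst Unique (sym (γ≡sortedColumns x)) (AllPairs.map⁺ (AllPairs-map-∈ distinctPositions (sortedColumns-sorted x)))
  where
  distinctPositions : ∀ {p q} → p ∈ sortedColumns x → q ∈ sortedColumns x → p ≺ q → proj₂ p ≢ proj₂ q
  distinctPositions p∈ q∈ (_ , p≢q) =
    p≢q ∘ columnsFrom-position-injective 1 x (∈-sortCols⁻ _ p∈) (∈-sortCols⁻ _ q∈)

at-extensionality : ∀ (a b : List ℕ) → length a ≡ length b →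
  (∀ i x y → at a i ≡ just x → at b i ≡ just y → x ≡ y) → a ≡ b
at-extensionality [] [] _ _ = refl
at-extensionality (x ∷ a) (y ∷ b) len entries =
  cong₂ _∷_ (entries 0 x y refl refl) (at-extensionality a b (suc-injective len) (entries ∘ suc))

map-≡⇒≡ : ∀ {A C : Set} (L : List A) (f g : A → C) → map f L ≡ map g L → ∀ {u} → u ∈ L → f u ≡ g u
map-≡⇒≡ (u ∷ L) f g fL≡gL (here refl) = proj₁ (∷-injective fL≡gL)
map-≡⇒≡ (u ∷ L) f g fL≡gL (there u∈) = map-≡⇒≡ L f g (proj₂ (∷-injective fL≡gL)) u∈

-- Sorting the paired columns sorts the columns of a and of b at once, and in both the sorted values are 1, …, n.
OrderIso-perm⇒≡ : ∀ a b → IsPerm a → IsPerm b → OrderIso a b → a ≡ b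
OrderIso-perm⇒≡ a b perm-a perm-b iso@(len , _) = at-extensionality a b len entries
  where
  open ≡-Reasoning
  Z : List ColumnPair
  Z = pairedColumns 1 a b
  L : List ColumnPair
  L = sortByFst Z
  sameValues : map (proj₁ ∘ proj₁) L ≡ map (proj₁ ∘ proj₂) L
  sameValues = begin
    map (proj₁ ∘ proj₁) L              ≡⟨ sortByFst-fst proj₁ Z ⟩
    map proj₁ (sortCols (map proj₁ Z)) ≡⟨ cong (map proj₁ ∘ sortCols) (map-proj₁-pairedColumns 1 a b len) ⟩
    map proj₁ (sortedColumns a)        ≡⟨ sortedValues-perm a perm-a ⟩
    upFrom 1 (maxL a)                  ≡⟨ cong (upFrom 1) (trans (maxL-perm a perm-a)
                                                             (trans len (sym (maxL-perm b perm-b)))) ⟩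
    upFrom 1 (maxL b)                  ≡⟨ sortedValues-perm b perm-b ⟨
    map proj₁ (sortedColumns b)        ≡⟨ cong (map proj₁ ∘ sortCols) (map-proj₂-pairedColumns 1 a b len) ⟨
    map proj₁ (sortCols (map proj₂ Z)) ≡⟨ sortByFst-snd proj₁ Z (pairedColumns-sameOrder a b iso) ⟨
    map (proj₁ ∘ proj₂) L              ∎
  entries : ∀ i x y → at a i ≡ just x → at b i ≡ just y → x ≡ y
  entries i x y at-a at-b =
    map-≡⇒≡ L (proj₁ ∘ proj₁) (proj₁ ∘ proj₂) sameValues (∈-sortByFst⁺ Z (∈-pairedColumns⁺ 1 a b i at-a at-b))

at-map-applyUpTo : ∀ n j (g f : ℕ → ℕ) → j < n → at (map f (applyUpTo g n)) j ≡ just (f (g j))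
at-map-applyUpTo (suc n) zero g f _ = refl
at-map-applyUpTo (suc n) (suc j) g f (s≤s j<n) = at-map-applyUpTo n j (g ∘ suc) f j<n

at-inv : ∀ σ j → j < length σ → at (inv σ) j ≡ just (pos (suc j) σ)
at-inv σ j = at-map-applyUpTo (length σ) j (λ i → i) (λ i → pos (suc i) σ)

length-inv : ∀ σ → length (inv σ) ≡ length σ
length-inv σ = trans (length-map _ (upTo (length σ))) (length-applyUpTo (λ i → i) (length σ))

pos-at : ∀ σ i {s} → Unique σ → at σ i ≡ just s → pos s σ ≡ suc i
pos-at (a ∷ σ) zero _ refl rewrite T⇒≡true (≡⇒≡ᵇ a a refl) = refl
pos-at (a ∷ σ) (suc i) {s} (a∉ ∷ u) at≡
  rewrite ¬T⇒≡false (λ t → All.lookup a∉ (at-∈ σ i at≡) (sym (≡ᵇ⇒≡ s a t))) =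
  cong suc (pos-at σ i u at≡)

module _ (σ : List ℕ) (perm : IsPerm σ) where

  private
    positive : All (1 ≤_) σ
    positive = proj₁ (proj₁ perm)
    covers : ∀ k → 1 ≤ k → k ≤ maxL σ → k ∈ σ
    covers = proj₂ (proj₁ perm)
    unique : Unique σ
    unique = proj₂ perm

  ∈-columns-inv⁺ : ∀ i {s} → at σ i ≡ just s → (suc i , s) ∈ columnsFrom 1 (inv σ)
  ∈-columns-inv⁺ i {zero} at≡ = ⊥-elim (<-irrefl refl (All.lookup positive (at-∈ σ i at≡)))
  ∈-columns-inv⁺ i {suc s} at≡ = subst (λ t → (t , suc s) ∈ columnsFrom 1 (inv σ)) (pos-at σ i unique at≡)
    (∈-columnsFrom⁺ 1 (inv σ) s (at-inv σ s (subst (suc s ≤_) (maxL-perm σ perm) (≤-maxL σ (at-∈ σ i at≡)))))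

  ∈-columns-inv⁻ : ∀ {v j} → (v , j) ∈ columnsFrom 1 (inv σ) → (j , v) ∈ columnsFrom 1 σ
  ∈-columns-inv⁻ v,j∈ with ∈-columnsFrom⁻ 1 (inv σ) v,j∈
  ... | j , refl , at≡ with at-<-length (inv σ) j at≡
  ... | j< with just-injective (trans (sym at≡) (at-inv σ j (subst (suc j ≤_) (length-inv σ) j<)))
  ... | refl with ∈-at σ (covers (suc j) (s≤s z≤n) (subst (suc j ≤_) (trans (length-inv σ) (sym (maxL-perm σ perm))) j<))
  ... | i , at-i rewrite pos-at σ i unique at-i = ∈-columnsFrom⁺ 1 σ i at-i

  -- The columns of inv σ are the flipped columns of σ, which are already in column order.
  γ-inv : γ (inv σ) ≡ σ
  γ-inv = begin
    γ (inv σ)                                ≡⟨ γ≡sortedColumns (inv σ) ⟩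
    map proj₂ (sortedColumns (inv σ))        ≡⟨ cong (map proj₂) (sortCols-unique _ flipped (columnsFrom-unique 1 (inv σ))
                                                  flipped-sorted flipped⊆ ⊆flipped) ⟩
    map proj₂ flipped                        ≡⟨ map-∘ (columnsFrom 1 σ) ⟨
    map proj₁ (columnsFrom 1 σ)              ≡⟨ map-proj₁-columnsFrom 1 σ ⟩
    σ                                        ∎
    where
    open ≡-Reasoning
    flipped : List Column
    flipped = map flipCol (columnsFrom 1 σ)
    flipped-sorted : Sorted flipped
    flipped-sorted = AllPairs.map⁺ (AllPairs.map
      (λ {(a , i)} {(b , j)} i<j → Before⁺ i a j b (inj₁ i<j) , λ i,a≡j,b → <-irrefl (cong proj₁ i,a≡j,b) i<j)
      (columnsFrom-increasing 1 σ))
    flipped⊆ : ∀ {e} → e ∈ flipped → e ∈ columnsFrom 1 (inv σ)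
    flipped⊆ e∈ with ∈-map⁻ flipCol e∈
    ... | (s , _) , s,k∈ , refl with ∈-columnsFrom⁻ 1 σ s,k∈
    ... | i , refl , at≡ = ∈-columns-inv⁺ i at≡
    ⊆flipped : ∀ {e} → e ∈ columnsFrom 1 (inv σ) → e ∈ flipped
    ⊆flipped {v , j} v,j∈ = ∈-map⁺ flipCol (∈-columns-inv⁻ v,j∈)

indicator : ∀ {P : Set} → Dec P → ℕ
indicator (yes _) = 1
indicator (no _) = 0

rank : List ℕ → ℕ → ℕ
rank w zero = indicator (0 ∈? w)
rank w (suc k) = indicator (suc k ∈? w) + rank w k

rank-zero-∈ : ∀ w → 0 ∈ w → rank w 0 ≡ 1
rank-zero-∈ w 0∈ with 0 ∈? w
... | yes _ = refl
... | no 0∉ = ⊥-elim (0∉ 0∈)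

rank-suc-∈ : ∀ w k → suc k ∈ w → rank w (suc k) ≡ suc (rank w k)
rank-suc-∈ w k k∈ with suc k ∈? w
... | yes _ = refl
... | no k∉ = ⊥-elim (k∉ k∈)

rank-mono : ∀ w x y → x ≤ y → rank w x ≤ rank w y
rank-mono w zero zero _ = ≤-refl
rank-mono w x (suc y) x≤ with x ≟ suc y
... | yes refl = ≤-refl
... | no x≢ = ≤-trans (rank-mono w x y (s≤s⁻¹ (≤∧≢⇒< x≤ x≢))) (m≤n+m (rank w y) (indicator (suc y ∈? w)))

rank-strict : ∀ w x y → y ∈ w → x < y → rank w x < rank w y
rank-strict w x (suc y) y∈ (s≤s x≤y) rewrite rank-suc-∈ w y y∈ = s≤s (rank-mono w x y x≤y)

rank-positive : ∀ w x → x ∈ w → 1 ≤ rank w x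
rank-positive w zero 0∈ rewrite rank-zero-∈ w 0∈ = ≤-refl
rank-positive w (suc x) x∈ rewrite rank-suc-∈ w x x∈ = s≤s z≤n

rank-surjective : ∀ w k j → 1 ≤ j → j ≤ rank w k → Σ ℕ λ x → x ∈ w × rank w x ≡ j
rank-surjective w zero j 1≤j j≤ with 0 ∈? w
... | yes 0∈ = 0 , 0∈ , trans (rank-zero-∈ w 0∈) (≤-antisym 1≤j j≤)
... | no _ = ⊥-elim (<-irrefl refl (≤-trans 1≤j j≤))
rank-surjective w (suc k) j 1≤j j≤ with suc k ∈? w
... | no _ = rank-surjective w k j 1≤j j≤
... | yes k∈ with j ≟ suc (rank w k)
...   | yes refl = suc k , k∈ , rank-suc-∈ w k k∈
...   | no j≢ = rank-surjective w k j 1≤j (s≤s⁻¹ (≤∧≢⇒< j≤ j≢))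

standardise : List ℕ → List ℕ
standardise w = map (rank w) w

standardise-OrderIso : ∀ w → OrderIso (standardise w) w
standardise-OrderIso w = subst (OrderIso (standardise w)) (map-id w) (OrderIso-map w (rank w) (λ x → x) agree)
  where
  agree : ∀ {x y} → x ∈ w → y ∈ w → Agree (rank w x , x) (rank w y , y)
  agree {x} {y} x∈ y∈ = mk⇔ rank<⇒< (rank-strict w x y y∈) , mk⇔ rank≡⇒≡ (cong (rank w))
    where
    rank<⇒< : rank w x < rank w y → x < y
    rank<⇒< r< = ≰⇒> (λ y≤x → <⇒≱ r< (rank-mono w y x y≤x))
    rank≡⇒≡ : rank w x ≡ rank w y → x ≡ y
    rank≡⇒≡ r≡ with <-cmp x y
    ... | tri< x<y _ _ = ⊥-elim (<-irrefl r≡ (rank-strict w x y y∈ x<y))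
    ... | tri≈ _ x≡y _ = x≡y
    ... | tri> _ _ y<x = ⊥-elim (<-irrefl (sym r≡) (rank-strict w y x x∈ y<x))

standardise-IsCayley : ∀ w → IsCayley (standardise w)
standardise-IsCayley w = All.tabulate positive , covers
  where
  positive : ∀ {x} → x ∈ standardise w → 1 ≤ x
  positive x∈ with ∈-map⁻ (rank w) x∈
  ... | x , x∈w , refl = rank-positive w x x∈w
  covers : ∀ k → 1 ≤ k → k ≤ maxL (standardise w) → k ∈ standardise w
  covers k 1≤k k≤ with maxL-∈ (standardise w)
  ... | inj₁ []≡ = ⊥-elim (<-irrefl refl (≤-trans 1≤k (subst (λ t → k ≤ maxL t) []≡ k≤)))
  ... | inj₂ max∈ with ∈-map⁻ (rank w) max∈
  ...   | x₀ , _ , max≡ with rank-surjective w x₀ k 1≤k (subst (k ≤_) max≡ k≤)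
  ...     | x , x∈w , refl = ∈-map⁺ (rank w) x∈w

-- An occurrence of σ in γ y selects columns of y; the entries of y in these columns, standardised,
-- give z, and γ z is then order isomorphic to σ, hence equal to it.
γ-Contains⁻ : ∀ y σ → IsPerm σ → Contains (γ y) σ → Σ (List ℕ) λ z → IsCayley z × γ z ≡ σ × Contains y z
γ-Contains⁻ y σ perm (u , u⊆ , u≅σ)
  with lift-⊆-map proj₂ (sortedColumns y) (subst (u ⊆_) (γ≡sortedColumns y) u⊆)
... | C , C⊆ , refl =
  standardise w , standardise-IsCayley w , γ-standardise ,
  w , w⊆y , OrderIso-sym {standardise w} {w} (standardise-OrderIso w)
  where
  D : List Column
  D = filter (_∈ᶜ? C) (columnsFrom 1 y)
  D⊆ : D ⊆ columnsFrom 1 y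
  D⊆ = Sublist.filter-⊆ (_∈ᶜ? C) (columnsFrom 1 y)
  w : List ℕ
  w = map proj₁ D
  w⊆y : w ⊆ y
  w⊆y = subst (w ⊆_) (map-proj₁-columnsFrom 1 y) (Sublist.map⁺ proj₁ D⊆)
  sortD≡C : sortCols D ≡ C
  sortD≡C = sortCols-unique D C (AllPairs-resp-⊆ (columnsFrom-unique 1 y) D⊆)
    (AllPairs-resp-⊆ (sortedColumns-sorted y) C⊆)
    (λ e∈C → ∈-filter⁺ (_∈ᶜ? C) (∈-sortCols⁻ (columnsFrom 1 y) (Sublist.Any-resp-⊆ C⊆ e∈C)) e∈C)
    (λ e∈D → proj₂ (∈-filter⁻ (_∈ᶜ? C) {xs = columnsFrom 1 y} e∈D))
  u≅γw : OrderIso (map proj₂ C) (γ w)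
  u≅γw = subst (λ S → OrderIso (map proj₂ S) (γ w)) sortD≡C (sortCols-sublist-OrderIso y D D⊆)
  γ-standardise : γ (standardise w) ≡ σ
  γ-standardise = OrderIso-perm⇒≡ (γ (standardise w)) σ (γ-IsPerm (standardise w)) perm
    (subst (λ t → OrderIso t σ) (sym (γ-resp-OrderIso (standardise w) w (standardise-OrderIso w)))
      (OrderIso-trans {γ w} {map proj₂ C} {σ} (OrderIso-sym {map proj₂ C} {γ w} u≅γw) u≅σ))

-- The Fishburn pattern

FishburnViolation : List ℕ → Set
FishburnViolation π = ∃ λ i → ∃ λ k → ∃ λ a → ∃ λ b → ∃ λ c →
  (suc i < k) × at π i ≡ just a × at π (suc i) ≡ just b × at π k ≡ just c × c < a × a < b × a ≡ suc c

data FishburnPattern : List ℕ → Set where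
  front : ∀ {a b c xs} → a < b → a ≡ suc c → c ∈ xs → FishburnPattern (a ∷ b ∷ xs)
  later : ∀ {x xs} → FishburnPattern xs → FishburnPattern (x ∷ xs)

FishburnPattern⇒Violation : ∀ {π} → FishburnPattern π → FishburnViolation π
FishburnPattern⇒Violation (front {a} {b} {c} {xs} a<b refl c∈) with ∈-at xs c∈
... | j , at≡ = 0 , suc (suc j) , a , b , c , s≤s (s≤s z≤n) , refl , refl , at≡ , ≤-refl , a<b , refl
FishburnPattern⇒Violation (later p) with FishburnPattern⇒Violation p
... | i , k , a , b , c , i+1<k , at-i , at-i+1 , at-k , rest =
  suc i , suc k , a , b , c , s≤s i+1<k , at-i , at-i+1 , at-k , rest

Violation⇒FishburnPattern : ∀ π → FishburnViolation π → FishburnPattern π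
Violation⇒FishburnPattern (x ∷ []) (zero , k , a , b , c , _ , _ , () , _)
Violation⇒FishburnPattern (x ∷ b ∷ xs) (zero , suc zero , _ , _ , _ , s≤s () , _)
Violation⇒FishburnPattern (x ∷ b ∷ xs) (zero , suc (suc k) , a , b′ , c , _ , refl , refl , at-k , _ , a<b , a≡) =
  front a<b a≡ (at-∈ xs k at-k)
Violation⇒FishburnPattern (x ∷ π) (suc i , suc k , a , b , c , s≤s i+1<k , at-i , at-i+1 , at-k , rest) =
  later (Violation⇒FishburnPattern π (i , k , a , b , c , i+1<k , at-i , at-i+1 , at-k , rest))

FishburnPattern-++ʳ : ∀ ys {xs} → FishburnPattern xs → FishburnPattern (ys ++ xs)
FishburnPattern-++ʳ [] p = p
FishburnPattern-++ʳ (y ∷ ys) p = later (FishburnPattern-++ʳ ys p)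

∈-++-insert : ∀ (L : List ℕ) {R N c} → c ∈ L ++ R → c ∈ L ++ N ∷ R
∈-++-insert L c∈ with ∈-++⁻ L c∈
... | inj₁ c∈L = ∈-++⁺ˡ c∈L
... | inj₂ c∈R = ∈-++⁺ʳ L (there c∈R)

∈-++-delete : ∀ (L : List ℕ) {R N c} → c ∈ L ++ N ∷ R → c ≢ N → c ∈ L ++ R
∈-++-delete L c∈ c≢N with ∈-++⁻ L c∈
... | inj₁ c∈L = ∈-++⁺ˡ c∈L
... | inj₂ (here c≡N) = ⊥-elim (c≢N c≡N)
... | inj₂ (there c∈R) = ∈-++⁺ʳ L c∈R

FishburnPattern-insert : ∀ L R N → FishburnPattern (L ++ R) → (∀ {x} → x ∈ L → x < N) → FishburnPattern (L ++ N ∷ R)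
FishburnPattern-insert [] R N p _ = later p
FishburnPattern-insert (x ∷ []) (b ∷ xs) N (front _ x≡ c∈) L<N = front (L<N (here refl)) x≡ (there c∈)
FishburnPattern-insert (x ∷ []) R N (later p) _ = later (later p)
FishburnPattern-insert (x ∷ b ∷ L) R N (front x<b x≡ c∈) _ = front x<b x≡ (∈-++-insert L c∈)
FishburnPattern-insert (x ∷ b ∷ L) R N (later p) L<N = later (FishburnPattern-insert (b ∷ L) R N p (L<N ∘ there))

Junction : List ℕ → List ℕ → Set
Junction L R = Σ (List ℕ) λ L′ → Σ ℕ λ c → L ≡ L′ ++ [ suc c ] × c ∈ R

Junction⇒FishburnPattern : ∀ L R N → Junction L R → (∀ {x} → x ∈ L → x < N) → FishburnPattern (L ++ N ∷ R)
Junction⇒FishburnPattern L R N (L′ , c , refl , c∈R) L<N =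
  subst FishburnPattern (sym (++-assoc L′ [ suc c ] (N ∷ R)))
    (FishburnPattern-++ʳ L′ (front (L<N (∈-++⁺ʳ L′ (here refl))) refl c∈R))

FishburnPattern-remove : ∀ L R N → FishburnPattern (L ++ N ∷ R) → (∀ {x} → x ∈ L ++ R → x < N) →
  FishburnPattern (L ++ R) ⊎ Junction L R
FishburnPattern-remove [] (b ∷ xs) N (front N<b _ _) <N = ⊥-elim (<-asym N<b (<N (here refl)))
FishburnPattern-remove [] R N (later p) _ = inj₁ p
FishburnPattern-remove (x ∷ []) R N (front _ x≡ c∈) _ = inj₂ ([] , _ , cong [_] x≡ , c∈)
FishburnPattern-remove (x ∷ []) (b ∷ xs) N (later (front N<b _ _)) <N = ⊥-elim (<-asym N<b (<N (there (here refl))))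
FishburnPattern-remove (x ∷ []) R N (later (later p)) _ = inj₁ (later p)
FishburnPattern-remove (x ∷ b ∷ L) R N (front x<b refl c∈) <N =
  inj₁ (front x<b refl (∈-++-delete L c∈ λ { refl → <-irrefl refl (<-trans (n<1+n N) (<N (here refl))) }))
FishburnPattern-remove (x ∷ b ∷ L) R N (later p) <N with FishburnPattern-remove (b ∷ L) R N p (<N ∘ there)
... | inj₁ p′ = inj₁ (later p′)
... | inj₂ (L′ , c , L≡ , c∈R) = inj₂ (x ∷ L′ , c , cong (x ∷_) L≡ , c∈R)

-- Invariants of modified ascent sequences

shift : ℕ → ℕ → ℕ
shift a c = if a ≤ᵇ c then suc c else c

shift-cases : ∀ a c → (c < a × shift a c ≡ c) ⊎ (a ≤ c × shift a c ≡ suc c)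
shift-cases a c with a ≤? c
... | yes a≤c rewrite T⇒≡true (≤⇒≤ᵇ a≤c) = inj₂ (a≤c , refl)
... | no a≰c rewrite ¬T⇒≡false (a≰c ∘ ≤ᵇ⇒≤ a c) = inj₁ (≰⇒> a≰c , refl)

shift-< : ∀ a c → c < a → shift a c ≡ c
shift-< a c c<a with shift-cases a c
... | inj₁ (_ , shift≡) = shift≡
... | inj₂ (a≤c , _) = ⊥-elim (<⇒≱ c<a a≤c)

shift-≥ : ∀ a c → a ≤ c → shift a c ≡ suc c
shift-≥ a c a≤c with shift-cases a c
... | inj₁ (c<a , _) = ⊥-elim (<⇒≱ c<a a≤c)
... | inj₂ (_ , shift≡) = shift≡

shift-mono-< : ∀ a c d → c < d → shift a c < shift a d
shift-mono-< a c d c<d with shift-cases a c | shift-cases a d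
... | inj₁ (_ , c≡)   | inj₁ (_ , d≡)   rewrite c≡ | d≡ = c<d
... | inj₁ (_ , c≡)   | inj₂ (_ , d≡)   rewrite c≡ | d≡ = <-trans c<d (n<1+n d)
... | inj₂ (a≤c , _)  | inj₁ (d<a , _)  = ⊥-elim (<⇒≱ (<-trans c<d d<a) a≤c)
... | inj₂ (_ , c≡)   | inj₂ (_ , d≡)   rewrite c≡ | d≡ = s≤s c<d

shift-cancel-< : ∀ a c d → shift a c < shift a d → c < d
shift-cancel-< a c d shift< with <-cmp c d
... | tri< c<d _ _ = c<d
... | tri≈ _ refl _ = ⊥-elim (<-irrefl refl shift<)
... | tri> _ _ d<c = ⊥-elim (<-asym shift< (shift-mono-< a d c d<c))

shift-injective : ∀ a c d → shift a c ≡ shift a d → c ≡ d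
shift-injective a c d shift≡ with <-cmp c d
... | tri< c<d _ _ = ⊥-elim (<-irrefl shift≡ (shift-mono-< a c d c<d))
... | tri≈ _ c≡d _ = c≡d
... | tri> _ _ d<c = ⊥-elim (<-irrefl (sym shift≡) (shift-mono-< a d c d<c))

shift-≢ : ∀ a c → shift a c ≢ a
shift-≢ a c shift≡a with shift-cases a c
... | inj₁ (c<a , shift≡) = <-irrefl (trans (sym shift≡) shift≡a) c<a
... | inj₂ (a≤c , shift≡) = <-irrefl refl (≤-<-trans a≤c (subst (c <_) (trans (sym shift≡) shift≡a) (n<1+n c)))

≤-shift : ∀ a c → c ≤ shift a c
≤-shift a c with shift-cases a c
... | inj₁ (_ , shift≡) = ≤-reflexive (sym shift≡)
... | inj₂ (_ , shift≡) = subst (c ≤_) (sym shift≡) (n≤1+n c)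

shift-≤-suc : ∀ a c → shift a c ≤ suc c
shift-≤-suc a c with shift-cases a c
... | inj₁ (_ , shift≡) = subst (_≤ suc c) (sym shift≡) (n≤1+n c)
... | inj₂ (_ , shift≡) = ≤-reflexive shift≡

shift-<ᵇ : ∀ a x y → (shift a x <ᵇ shift a y) ≡ (x <ᵇ y)
shift-<ᵇ a x y = T-ext (<⇒<ᵇ ∘ shift-cancel-< a x y ∘ <ᵇ⇒< _ _) (<⇒<ᵇ ∘ shift-mono-< a x y ∘ <ᵇ⇒< x y)

at-snoc-init : ∀ (v : List ℕ) a i {x} → at v i ≡ just x → at (v ++ [ a ]) i ≡ just x
at-snoc-init (b ∷ v) a zero at≡ = at≡
at-snoc-init (b ∷ v) a (suc i) at≡ = at-snoc-init v a i at≡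

at-snoc-last : ∀ (v : List ℕ) a → at (v ++ [ a ]) (length v) ≡ just a
at-snoc-last [] a = refl
at-snoc-last (b ∷ v) a = at-snoc-last v a

at-snoc⁻ : ∀ (v : List ℕ) a i {x} → at (v ++ [ a ]) i ≡ just x → at v i ≡ just x ⊎ (i ≡ length v × x ≡ a)
at-snoc⁻ [] a zero refl = inj₂ (refl , refl)
at-snoc⁻ (b ∷ v) a zero at≡ = inj₁ at≡
at-snoc⁻ (b ∷ v) a (suc i) at≡ with at-snoc⁻ v a i at≡
... | inj₁ at≡′ = inj₁ at≡′
... | inj₂ (i≡ , x≡) = inj₂ (cong suc i≡ , x≡)

at-snoc-init⁻ : ∀ (v : List ℕ) a i {x} → i < length v → at (v ++ [ a ]) i ≡ just x → at v i ≡ just x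
at-snoc-init⁻ v a i i< at≡ with at-snoc⁻ v a i at≡
... | inj₁ at≡′ = at≡′
... | inj₂ (refl , _) = ⊥-elim (<-irrefl refl i<)

at-map⁺ : ∀ (f : ℕ → ℕ) (v : List ℕ) i {x} → at v i ≡ just x → at (map f v) i ≡ just (f x)
at-map⁺ f (b ∷ v) zero refl = refl
at-map⁺ f (b ∷ v) (suc i) at≡ = at-map⁺ f v i at≡

at-map⁻ : ∀ (f : ℕ → ℕ) (v : List ℕ) i {x′} → at (map f v) i ≡ just x′ → Σ ℕ λ x → at v i ≡ just x × x′ ≡ f x
at-map⁻ f (b ∷ v) zero refl = b , refl , refl
at-map⁻ f (b ∷ v) (suc i) at≡ = at-map⁻ f v i at≡

AbsentUpTo : List ℕ → ℕ → ℕ → Set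
AbsentUpTo v i x = ∀ j → j ≤ i → at v j ≢ just x

NewValuesAscend : List ℕ → Set
NewValuesAscend v = ∀ i x y → at v i ≡ just y → at v (suc i) ≡ just x → AbsentUpTo v i x → y < x

AscentsReachNewValues : List ℕ → Set
AscentsReachNewValues v = ∀ i x y → at v i ≡ just y → at v (suc i) ≡ just x → y < x → AbsentUpTo v i x

length-snoc : ∀ (w : List ℕ) b → length (w ++ [ b ]) ≡ suc (length w)
length-snoc [] b = refl
length-snoc (x ∷ w) b = cong suc (length-snoc w b)

snoc≢[] : ∀ (w : List ℕ) {b} → w ++ [ b ] ≢ []
snoc≢[] w w++b≡[] with ++-conicalʳ w _ w++b≡[]
... | ()

AbsentUpTo-snoc⁻ : ∀ v a i {x} → AbsentUpTo (v ++ [ a ]) i x → AbsentUpTo v i x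
AbsentUpTo-snoc⁻ v a i absent j j≤i at≡ = absent j j≤i (at-snoc-init v a j at≡)

module _ (w : List ℕ) (b a : ℕ) where

  private
    v : List ℕ
    v = w ++ [ b ]

    init-entry : ∀ i j {y} → j ≤ i → at (v ++ [ a ]) (suc i) ≡ just y → ∀ {x} → at (v ++ [ a ]) j ≡ just x →
      (at v (suc i) ≡ just y × at v j ≡ just x) ⊎ (i ≡ length w × y ≡ a × at v j ≡ just x)
    init-entry i j j≤i at-i+1 at-j with at-snoc⁻ v a (suc i) at-i+1
    ... | inj₁ at-i+1′ =
      inj₁ (at-i+1′ , at-snoc-init⁻ v a j (≤-<-trans j≤i (<-trans (n<1+n i) (at-<-length v (suc i) at-i+1′))) at-j)
    ... | inj₂ (i+1≡ , y≡a) with suc-injective (trans i+1≡ (length-snoc w b))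
    ...   | refl = inj₂ (refl , y≡a , at-snoc-init⁻ v a j (subst (_ <_) (sym (length-snoc w b)) (s≤s j≤i)) at-j)

  NewValuesAscend-snoc : NewValuesAscend v → (AbsentUpTo v (length w) a → b < a) → NewValuesAscend (v ++ [ a ])
  NewValuesAscend-snoc ascend last i x y at-i at-i+1 absent with init-entry i i ≤-refl at-i+1 at-i
  ... | inj₁ (at-i+1′ , at-i′) = ascend i x y at-i′ at-i+1′ (AbsentUpTo-snoc⁻ v a i absent)
  ... | inj₂ (refl , refl , at-i′) with just-injective (trans (sym at-i′) (at-snoc-last w b))
  ...   | refl = last (AbsentUpTo-snoc⁻ v a i absent)

  AscentsReachNewValues-snoc : AscentsReachNewValues v → (b < a → AbsentUpTo v (length w) a) →
    AscentsReachNewValues (v ++ [ a ])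
  AscentsReachNewValues-snoc reach last i x y at-i at-i+1 y<x j j≤i at-j with init-entry i j j≤i at-i+1 at-j
  ... | inj₁ (at-i+1′ , at-j′) =
    reach i x y (at-snoc-init⁻ v a i (<-trans (n<1+n i) (at-<-length v (suc i) at-i+1′)) at-i) at-i+1′ y<x j j≤i at-j′
  ... | inj₂ (refl , refl , at-j′)
    with just-injective (trans (sym (at-snoc-init⁻ v a i (subst (_ <_) (sym (length-snoc w b)) (n<1+n i)) at-i))
                               (at-snoc-last w b))
  ...   | refl = last y<x j j≤i at-j′

NewValuesAscend-bump : ∀ a v → NewValuesAscend v → NewValuesAscend (bump a v)
NewValuesAscend-bump a v ascend i x′ y′ at-i at-i+1 absent
  with at-map⁻ (shift a) v i at-i | at-map⁻ (shift a) v (suc i) at-i+1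
... | y , at-i′ , refl | x , at-i+1′ , refl =
  shift-mono-< a y x (ascend i x y at-i′ at-i+1′ (λ j j≤i at-j → absent j j≤i (at-map⁺ (shift a) v j at-j)))

AscentsReachNewValues-bump : ∀ a v → AscentsReachNewValues v → AscentsReachNewValues (bump a v)
AscentsReachNewValues-bump a v reach i x′ y′ at-i at-i+1 y′<x′ j j≤i at-j
  with at-map⁻ (shift a) v i at-i | at-map⁻ (shift a) v (suc i) at-i+1 | at-map⁻ (shift a) v j at-j
... | y , at-i′ , refl | x , at-i+1′ , refl | x₂ , at-j′ , x≡ =
  reach i x y at-i′ at-i+1′ (shift-cancel-< a y x y′<x′) j j≤i
    (subst (λ t → at v j ≡ just t) (sym (shift-injective a x x₂ x≡)) at-j′)

asc-snoc : ∀ (w : List ℕ) b a → asc ((w ++ [ b ]) ++ [ a ]) ≡ asc (w ++ [ b ]) + (if b <ᵇ a then 1 else 0)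
asc-snoc [] b a = +-identityʳ _
asc-snoc (x ∷ []) b a =
  trans (cong ((if x <ᵇ b then 1 else 0) +_) (+-identityʳ _))
        (cong (_+ (if b <ᵇ a then 1 else 0)) (sym (+-identityʳ _)))
asc-snoc (x ∷ y ∷ w) b a =
  trans (cong ((if x <ᵇ y then 1 else 0) +_) (asc-snoc (y ∷ w) b a)) (sym (+-assoc (if x <ᵇ y then 1 else 0) _ _))

asc-descent : ∀ w b a → a ≤ b → asc ((w ++ [ b ]) ++ [ a ]) ≡ asc (w ++ [ b ])
asc-descent w b a a≤b rewrite asc-snoc w b a | ¬T⇒≡false (λ b<a → <⇒≱ (<ᵇ⇒< b a b<a) a≤b) = +-identityʳ _

asc-ascent : ∀ w b a → b < a → asc ((w ++ [ b ]) ++ [ a ]) ≡ suc (asc (w ++ [ b ]))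
asc-ascent w b a b<a rewrite asc-snoc w b a | T⇒≡true (<⇒<ᵇ b<a) = +-comm _ 1

asc-bump : ∀ a v → asc (bump a v) ≡ asc v
asc-bump a [] = refl
asc-bump a (x ∷ []) = refl
asc-bump a (x ∷ y ∷ v) = cong₂ _+_ (cong (λ t → if t then 1 else 0) (shift-<ᵇ a x y)) (asc-bump a (y ∷ v))

maxL-snoc-∈ : ∀ v {a} → a ∈ v → maxL (v ++ [ a ]) ≡ maxL v
maxL-snoc-∈ v {a} a∈ = ≤-antisym (maxL-≤ (v ++ [ a ]) bound) (maxL-≤ v (≤-maxL (v ++ [ a ]) ∘ ∈-++⁺ˡ))
  where
  bound : ∀ {x} → x ∈ v ++ [ a ] → x ≤ maxL v
  bound x∈ with ∈-++⁻ v x∈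
  ... | inj₁ x∈v = ≤-maxL v x∈v
  ... | inj₂ (here refl) = ≤-maxL v a∈

IsCayley-snoc-∈ : ∀ v {a} → IsCayley v → 1 ≤ a → a ∈ v → IsCayley (v ++ [ a ])
IsCayley-snoc-∈ v (positive , covers) 1≤a a∈ =
  All.∷ʳ⁺ positive 1≤a , λ k 1≤k k≤ → ∈-++⁺ˡ (covers k 1≤k (subst (k ≤_) (maxL-snoc-∈ v a∈) k≤))

module _ (a : ℕ) (v : List ℕ) (a≤ : a ≤ suc (maxL v)) where

  jump-bounded : ∀ {x} → x ∈ bump a v ++ [ a ] → x ≤ suc (maxL v)
  jump-bounded x∈ with ∈-++⁻ (bump a v) x∈
  ... | inj₂ (here refl) = a≤
  ... | inj₁ x∈bump with ∈-map⁻ (shift a) x∈bump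
  ...   | x , x∈v , refl = ≤-trans (shift-≤-suc a x) (s≤s (≤-maxL v x∈v))

  IsCayley-jump : IsCayley v → 1 ≤ a → IsCayley (bump a v ++ [ a ])
  IsCayley-jump (positive , covers) 1≤a = All.∷ʳ⁺ (All.tabulate shifted-positive) 1≤a , covers′
    where
    shifted-positive : ∀ {x} → x ∈ bump a v → 1 ≤ x
    shifted-positive x∈ with ∈-map⁻ (shift a) x∈
    ... | x , x∈v , refl = ≤-trans (All.lookup positive x∈v) (≤-shift a x)
    covers′ : ∀ k → 1 ≤ k → k ≤ maxL (bump a v ++ [ a ]) → k ∈ bump a v ++ [ a ]
    covers′ k 1≤k k≤ with <-cmp k a
    ... | tri≈ _ refl _ = ∈-++⁺ʳ (bump a v) (here refl)
    ... | tri< k<a _ _ = ∈-++⁺ˡ (subst (_∈ bump a v) (shift-< a k k<a)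
            (∈-map⁺ (shift a) (covers k 1≤k (s≤s⁻¹ (≤-trans k<a a≤)))))
    covers′ (suc k) _ k≤ | tri> _ _ a<k = ∈-++⁺ˡ (subst (_∈ bump a v) (shift-≥ a k (s≤s⁻¹ a<k))
            (∈-map⁺ (shift a) (covers k (≤-trans 1≤a (s≤s⁻¹ a<k))
              (s≤s⁻¹ (≤-trans k≤ (maxL-≤ (bump a v ++ [ a ]) jump-bounded))))))

  maxL-jump : v ≢ [] → maxL (bump a v ++ [ a ]) ≡ suc (maxL v)
  maxL-jump v≢[] = ≤-antisym (maxL-≤ (bump a v ++ [ a ]) jump-bounded) (≤-maxL (bump a v ++ [ a ]) 1+max∈)
    where
    1+max∈ : suc (maxL v) ∈ bump a v ++ [ a ]
    1+max∈ with a ≤? maxL v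
    ... | no a≰max = ∈-++⁺ʳ (bump a v) (here (≤-antisym (≰⇒> a≰max) a≤))
    ... | yes a≤max with maxL-∈ v
    ...   | inj₁ v≡[] = ⊥-elim (v≢[] v≡[])
    ...   | inj₂ max∈ = ∈-++⁺ˡ (subst (_∈ bump a v) (shift-≥ a (maxL v) a≤max) (∈-map⁺ (shift a) max∈))

record ModascInvariant (v : List ℕ) : Set where
  field
    cayley                : IsCayley v
    newValuesAscend       : NewValuesAscend v
    ascentsReachNewValues : AscentsReachNewValues v
    maxL≡1+asc            : v ≡ [] ⊎ maxL v ≡ suc (asc v)

maxL≡1+asc-snoc : ∀ {w b} → ModascInvariant (w ++ [ b ]) → maxL (w ++ [ b ]) ≡ suc (asc (w ++ [ b ]))
maxL≡1+asc-snoc {w} invariant with ModascInvariant.maxL≡1+asc invariant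
... | inj₁ w++b≡[] = ⊥-elim (snoc≢[] w w++b≡[])
... | inj₂ max≡ = max≡

module _ (w : List ℕ) (b a : ℕ) (invariant : ModascInvariant (w ++ [ b ])) where

  open ModascInvariant invariant
  open ≡-Reasoning

  private
    v : List ℕ
    v = w ++ [ b ]

  ModascInvariant-stay : 1 ≤ a → a ≤ b → ModascInvariant (v ++ [ a ])
  ModascInvariant-stay 1≤a a≤b = record
    { cayley = IsCayley-snoc-∈ v cayley 1≤a a∈
    ; newValuesAscend = NewValuesAscend-snoc w b a newValuesAscend old
    ; ascentsReachNewValues = AscentsReachNewValues-snoc w b a ascentsReachNewValues (λ b<a → ⊥-elim (<⇒≱ b<a a≤b))
    ; maxL≡1+asc = inj₂ (begin
        maxL (v ++ [ a ])      ≡⟨ maxL-snoc-∈ v a∈ ⟩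
        maxL v                 ≡⟨ maxL≡1+asc-snoc invariant ⟩
        suc (asc v)            ≡⟨ cong suc (asc-descent w b a a≤b) ⟨
        suc (asc (v ++ [ a ])) ∎)
    }
    where
    a∈ : a ∈ v
    a∈ = proj₂ cayley a 1≤a (≤-trans a≤b (≤-maxL v (∈-++⁺ʳ w (here refl))))
    old : AbsentUpTo v (length w) a → b < a
    old absent with ∈-at v a∈
    ... | j , at-j = ⊥-elim (absent j (s≤s⁻¹ (subst (suc j ≤_) (length-snoc w b) (at-<-length v j at-j))) at-j)

  ModascInvariant-jump : b < a → a ≤ 2 + asc v → ModascInvariant (bump a v ++ [ a ])
  ModascInvariant-jump b<a a≤ = record
    { cayley = IsCayley-jump a v a≤1+max cayley (≤-trans (s≤s z≤n) b<a)
    ; newValuesAscend = subst (λ u → NewValuesAscend (u ++ [ a ])) (sym bump≡)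
        (NewValuesAscend-snoc (bump a w) b a (subst NewValuesAscend bump≡ (NewValuesAscend-bump a v newValuesAscend))
          (λ _ → b<a))
    ; ascentsReachNewValues = subst (λ u → AscentsReachNewValues (u ++ [ a ])) (sym bump≡)
        (AscentsReachNewValues-snoc (bump a w) b a
          (subst AscentsReachNewValues bump≡ (AscentsReachNewValues-bump a v ascentsReachNewValues))
          (λ _ j _ at-j → a∉bump (subst (a ∈_) (sym bump≡) (at-∈ (bump a w ++ [ b ]) j at-j))))
    ; maxL≡1+asc = inj₂ (begin
        maxL (bump a v ++ [ a ])                 ≡⟨ maxL-jump a v a≤1+max (snoc≢[] w) ⟩
        suc (maxL v)                             ≡⟨ cong suc (maxL≡1+asc-snoc invariant) ⟩
        suc (suc (asc v))                        ≡⟨ cong (suc ∘ suc) (asc-bump a v) ⟨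
        suc (suc (asc (bump a v)))               ≡⟨ cong (λ u → suc (suc (asc u))) bump≡ ⟩
        suc (suc (asc (bump a w ++ [ b ])))      ≡⟨ cong suc (asc-ascent (bump a w) b a b<a) ⟨
        suc (asc ((bump a w ++ [ b ]) ++ [ a ])) ≡⟨ cong (λ u → suc (asc (u ++ [ a ]))) bump≡ ⟨
        suc (asc (bump a v ++ [ a ]))            ∎)
    }
    where
    a≤1+max : a ≤ suc (maxL v)
    a≤1+max = subst (λ m → a ≤ suc m) (sym (maxL≡1+asc-snoc invariant)) a≤
    bump≡ : bump a v ≡ bump a w ++ [ b ]
    bump≡ = trans (map-++ (shift a) w [ b ]) (cong (λ c → bump a w ++ [ c ]) (shift-< a b b<a))
    a∉bump : a ∉ bump a v
    a∉bump a∈ with ∈-map⁻ (shift a) a∈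
    ... | c , _ , a≡ = shift-≢ a c (sym a≡)

modasc-invariant : ∀ {v} → Modasc v → ModascInvariant v
modasc-invariant mEmpty = record
  { cayley = [] , λ k 1≤k k≤0 → ⊥-elim (<-irrefl refl (≤-trans 1≤k k≤0))
  ; newValuesAscend = λ _ _ _ ()
  ; ascentsReachNewValues = λ _ _ _ ()
  ; maxL≡1+asc = inj₁ refl
  }
modasc-invariant mOne = record
  { cayley = s≤s z≤n ∷ [] , λ k 1≤k k≤1 → here (≤-antisym k≤1 1≤k)
  ; newValuesAscend = λ _ _ _ _ ()
  ; ascentsReachNewValues = λ _ _ _ _ ()
  ; maxL≡1+asc = inj₂ refl
  }
modasc-invariant (mStay {b = b} {a} mv (w , refl) 1≤a a≤b) = ModascInvariant-stay w b a (modasc-invariant mv) 1≤a a≤b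
modasc-invariant (mJump {b = b} {a} mv (w , refl) b<a a≤) = ModascInvariant-jump w b a (modasc-invariant mv) b<a a≤

-- γ of a growth step

record SplitBy (a : ℕ) (S : List Column) : Set where
  constructor splitBy
  field
    low high : List Column
    S≡    : S ≡ low ++ high
    low<  : ∀ {p} → p ∈ low → proj₁ p < a
    ≤high : ∀ {p} → p ∈ high → a ≤ proj₁ p

StrictlyMonotone : (ℕ → ℕ) → Set
StrictlyMonotone f = ∀ {x y} → x < y → f x < f y

StrictlyMonotone⇒Agree : ∀ {f} → StrictlyMonotone f → ∀ x y → Agree (x , f x) (y , f y)
StrictlyMonotone⇒Agree {f} mono x y = mk⇔ mono reflect< , mk⇔ (cong f) reflect≡
  where
  reflect< : f x < f y → x < y
  reflect< fx<fy with <-cmp x y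
  ... | tri< x<y _ _ = x<y
  ... | tri≈ _ refl _ = ⊥-elim (<-irrefl refl fx<fy)
  ... | tri> _ _ y<x = ⊥-elim (<-asym fx<fy (mono y<x))
  reflect≡ : f x ≡ f y → x ≡ y
  reflect≡ fx≡fy with <-cmp x y
  ... | tri< x<y _ _ = ⊥-elim (<-irrefl fx≡fy (mono x<y))
  ... | tri≈ _ x≡y _ = x≡y
  ... | tri> _ _ y<x = ⊥-elim (<-irrefl (sym fx≡fy) (mono y<x))

≺-onValue : ∀ {f} → StrictlyMonotone f → ∀ {p q} → p ≺ q → onValue f p ≺ onValue f q
≺-onValue {f} mono {x , i} {y , j} (p≤q , p≢q) =
  subst T (before-resp-Agree x y (f x) (f y) i j (StrictlyMonotone⇒Agree mono x y)) p≤q ,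
  λ fp≡fq → p≢q (cong₂ _,_ (Equivalence.from (proj₂ (StrictlyMonotone⇒Agree mono x y)) (cong proj₁ fp≡fq))
                           (cong proj₂ fp≡fq))

record Admissible (a : ℕ) (f : ℕ → ℕ) : Set where
  field
    mono  : StrictlyMonotone f
    below : ∀ {c} → c < a → f c < a
    above : ∀ {c} → a ≤ c → a ≤ f c

id-admissible : ∀ a → Admissible a (λ c → c)
id-admissible a = record { mono = λ c<d → c<d ; below = λ c<a → c<a ; above = λ a≤c → a≤c }

shift-admissible : ∀ a → Admissible a (shift a)
shift-admissible a = record
  { mono = shift-mono-< a _ _
  ; below = λ {c} c<a → subst (_< a) (sym (shift-< a c c<a)) c<a
  ; above = λ {c} a≤c → ≤-trans a≤c (≤-shift a c)
  }

module _ {a f} (adm : Admissible a f) (v : List ℕ) (sp : SplitBy a (sortedColumns v)) where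

  open Admissible adm
  open SplitBy sp

  private
    N : ℕ
    N = suc (length v)
    grown : List Column
    grown = map (onValue f) low ++ (a , N) ∷ map (onValue f) high

    ∈-split⁻ : ∀ {p} → p ∈ low ++ high → p ∈ columnsFrom 1 v
    ∈-split⁻ p∈ = ∈-sortCols⁻ _ (subst (_ ∈_) (sym S≡) p∈)

    ∈-split⁺ : ∀ {p} → p ∈ columnsFrom 1 v → p ∈ low ++ high
    ∈-split⁺ p∈ = subst (_ ∈_) S≡ (∈-sortCols⁺ _ p∈)

    columns≡ : columnsFrom 1 (map f v ++ [ a ]) ≡ map (onValue f) (columnsFrom 1 v) ++ [ (a , N) ]
    columns≡ = trans (columnsFrom-++ 1 (map f v) a)
      (cong₂ (λ cs n → cs ++ [ (a , suc n) ]) (columnsFrom-map 1 v f) (length-map f v))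

    grown⊆ : ∀ {e} → e ∈ grown → e ∈ map (onValue f) (columnsFrom 1 v) ++ [ (a , N) ]
    grown⊆ e∈ with ∈-++⁻ (map (onValue f) low) e∈
    ... | inj₂ (here refl) = ∈-++⁺ʳ _ (here refl)
    ... | inj₁ e∈low with ∈-map⁻ (onValue f) e∈low
    ...   | p , p∈ , refl = ∈-++⁺ˡ (∈-map⁺ (onValue f) (∈-split⁻ (∈-++⁺ˡ p∈)))
    grown⊆ e∈ | inj₂ (there e∈high) with ∈-map⁻ (onValue f) e∈high
    ...   | p , p∈ , refl = ∈-++⁺ˡ (∈-map⁺ (onValue f) (∈-split⁻ (∈-++⁺ʳ low p∈)))

    ⊆grown : ∀ {e} → e ∈ map (onValue f) (columnsFrom 1 v) ++ [ (a , N) ] → e ∈ grown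
    ⊆grown e∈ with ∈-++⁻ (map (onValue f) (columnsFrom 1 v)) e∈
    ... | inj₂ (here refl) = ∈-++⁺ʳ _ (here refl)
    ... | inj₁ e∈cols with ∈-map⁻ (onValue f) e∈cols
    ...   | p , p∈ , refl with ∈-++⁻ low (∈-split⁺ p∈)
    ...     | inj₁ p∈low = ∈-++⁺ˡ (∈-map⁺ (onValue f) p∈low)
    ...     | inj₂ p∈high = ∈-++⁺ʳ _ (there (∈-map⁺ (onValue f) p∈high))

  private
    f-low : ∀ {p} → p ∈ low → f (proj₁ p) < a
    f-low = below ∘ low<

    f-high : ∀ {p} → p ∈ high → a ≤ f (proj₁ p)
    f-high = above ∘ ≤high

    sorted : Sorted (low ++ high)
    sorted = subst Sorted S≡ (sortedColumns-sorted v)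

    new≺high : ∀ {q} → q ∈ map (onValue f) high → (a , N) ≺ q
    new≺high q∈ with ∈-map⁻ (onValue f) q∈
    ... | (c , d) , cd∈ , refl with m≤n⇒m<n∨m≡n (f-high cd∈)
    ...   | inj₁ a<fc = Before⁺ a N (f c) d (inj₁ a<fc) , λ e → <-irrefl (cong proj₁ e) a<fc
    ...   | inj₂ refl = Before⁺ a N (f c) d (inj₂ (refl , <⇒≤ d<N)) , λ e → <-irrefl (sym (cong proj₂ e)) d<N
      where
      d<N : d < N
      d<N = columnsFrom-position< 1 v (∈-split⁻ (∈-++⁺ʳ low cd∈))

    low≺ : ∀ {p q} → p ∈ map (onValue f) low → q ∈ (a , N) ∷ map (onValue f) high → p ≺ q
    low≺ p∈ q∈ with ∈-map⁻ (onValue f) p∈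
    low≺ p∈ (here refl) | (c , d) , cd∈ , refl =
      Before⁺ (f c) d a N (inj₁ (f-low cd∈)) , λ e → <-irrefl (cong proj₁ e) (f-low cd∈)
    low≺ p∈ (there q∈) | p′ , p′∈ , refl with ∈-map⁻ (onValue f) q∈
    ... | q′ , q′∈ , refl = ≺-onValue mono (AllPairs-++-between low sorted p′∈ q′∈)

    grown-sorted : Sorted grown
    grown-sorted =
      AllPairs.++⁺ (AllPairs.map⁺ (AllPairs.map (≺-onValue mono) (AllPairs-++⁻ˡ low sorted)))
        (All.tabulate new≺high ∷ AllPairs.map⁺ (AllPairs.map (≺-onValue mono) (AllPairs-++⁻ʳ low sorted)))
        (All.tabulate (λ p∈ → All.tabulate (low≺ p∈)))

  sortedColumns-growth :
    sortedColumns (map f v ++ [ a ]) ≡ map (onValue f) low ++ (a , suc (length v)) ∷ map (onValue f) high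
  sortedColumns-growth = sortCols-unique _ grown (columnsFrom-unique 1 _) grown-sorted
    (λ e∈ → subst (_ ∈_) (sym columns≡) (grown⊆ e∈)) (λ e∈ → ⊆grown (subst (_ ∈_) columns≡ e∈))

  γ-growth : γ (map f v ++ [ a ]) ≡ map proj₂ low ++ suc (length v) ∷ map proj₂ high
  γ-growth = begin
    γ (map f v ++ [ a ])                           ≡⟨ γ≡sortedColumns (map f v ++ [ a ]) ⟩
    map proj₂ (sortedColumns (map f v ++ [ a ]))   ≡⟨ cong (map proj₂) sortedColumns-growth ⟩
    map proj₂ grown                                ≡⟨ map-++ proj₂ (map (onValue f) low) _ ⟩
    map proj₂ (map (onValue f) low) ++ N ∷ map proj₂ (map (onValue f) high)
                                                   ≡⟨ cong₂ (λ s t → s ++ N ∷ t) (map-∘ low) (map-∘ high) ⟨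
    map proj₂ low ++ N ∷ map proj₂ high            ∎
    where open ≡-Reasoning

-- Images of modified ascent sequences are Fishburn permutations

splitBy-sorted : ∀ a S → Sorted S → SplitBy a S
splitBy-sorted a [] _ = splitBy [] [] refl (λ ()) (λ ())
splitBy-sorted a (s ∷ S) (s≺ ∷ sorted) with proj₁ s <? a
... | yes s<a = let open SplitBy (splitBy-sorted a S sorted) in
  splitBy (s ∷ low) high (cong (s ∷_) S≡) (λ { (here refl) → s<a ; (there p∈) → low< p∈ }) ≤high
... | no s≮a = splitBy [] (s ∷ S) refl (λ ()) λ
  { (here refl) → ≮⇒≥ s≮a
  ; {p} (there p∈) → ≤-trans (≮⇒≥ s≮a) (Before⇒≤ s p (proj₁ (All.lookup s≺ p∈))) }

map-snoc⁻ : ∀ {A B : Set} (f : A → B) (S : List A) (L : List B) z → map f S ≡ L ++ [ z ] →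
  Σ (List A) λ S′ → Σ A λ p → S ≡ S′ ++ [ p ] × f p ≡ z
map-snoc⁻ f S L z fS≡ with map-++⁻ f S L [ z ] fS≡
... | S′ , p ∷ [] , S≡ , _ , fp≡ = S′ , p , S≡ , proj₁ (∷-injective fp≡)
... | _ , [] , _ , _ , ()
... | _ , _ ∷ _ ∷ _ , _ , _ , ()

γ≡split : ∀ {a} v (sp : SplitBy a (sortedColumns v)) →
  γ v ≡ map proj₂ (SplitBy.low sp) ++ map proj₂ (SplitBy.high sp)
γ≡split v (splitBy low high S≡ _ _) =
  trans (γ≡sortedColumns v) (trans (cong (map proj₂) S≡) (map-++ proj₂ low high))

-- The last column of low is the first occurrence of its value x, and the entry just before it lies in high,
-- so it exceeds x: a new value reached by a descent.
NewValuesAscend⇒¬Junction : ∀ {a} v (sp : SplitBy a (sortedColumns v)) → NewValuesAscend v →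
  ¬ Junction (map proj₂ (SplitBy.low sp)) (map proj₂ (SplitBy.high sp))
NewValuesAscend⇒¬Junction {a} v (splitBy low high S≡ low< ≤high) ascend (L , c , L≡ , c∈)
  with map-snoc⁻ proj₂ low L (suc c) L≡ | ∈-map⁻ proj₂ c∈
... | low′ , (x , _) , refl , refl | (y , _) , y∈high , refl
  with ∈-sortedColumns⁻ v (subst (_ ∈_) (sym S≡) (∈-++⁺ʳ (low′ ++ [ (x , suc c) ]) y∈high))
     | ∈-sortedColumns⁻ v (subst (_ ∈_) (sym S≡) (∈-++⁺ˡ {ys = high} (∈-++⁺ʳ low′ (here refl))))
... | i , refl , at-i | _ , refl , at-i+1 =
  <-irrefl refl (<-trans (ascend i x y at-i at-i+1 absent) (<-≤-trans (low< x∈low) (≤high y∈high)))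
  where
  x∈low : (x , suc (suc i)) ∈ low′ ++ [ (x , suc (suc i)) ]
  x∈low = ∈-++⁺ʳ low′ (here refl)
  low′-sorted : ∀ {p} → p ∈ low′ → p ≺ (x , suc (suc i))
  low′-sorted = AllPairs-to-last low′ (subst Sorted S≡ (sortedColumns-sorted v))
  absent : AbsentUpTo v i x
  absent j j≤i at-j with ∈-++⁻ (low′ ++ [ (x , suc (suc i)) ]) (subst (_ ∈_) S≡ (∈-sortedColumns⁺ v j at-j))
  ... | inj₂ x∈high = <-irrefl refl (<-≤-trans (low< x∈low) (≤high x∈high))
  ... | inj₁ x∈ with ∈-++⁻ low′ x∈
  ...   | inj₂ (here j+1≡) = <-irrefl (suc-injective (cong proj₂ j+1≡)) (s≤s j≤i)
  ...   | inj₁ x∈low′ with Before⁻ x (suc j) x (suc (suc i)) (proj₁ (low′-sorted x∈low′))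
  ...     | inj₁ x<x = <-irrefl refl x<x
  ...     | inj₂ (_ , i+2≤j+1) = <-irrefl refl (≤-trans (s≤s (s≤s j≤i)) i+2≤j+1)

¬FishburnPattern-growth : ∀ {a f} → Admissible a f → ∀ v → NewValuesAscend v → ¬ FishburnPattern (γ v) →
  ¬ FishburnPattern (γ (map f v ++ [ a ]))
¬FishburnPattern-growth {a} adm v ascend avoids occurrence =
  [ avoids ∘ subst FishburnPattern (sym (γ≡split v sp)) , NewValuesAscend⇒¬Junction v sp ascend ]′
    (FishburnPattern-remove (map proj₂ low) (map proj₂ high) (suc (length v))
      (subst FishburnPattern (γ-growth adm v sp) occurrence) below)
  where
  sp : SplitBy a (sortedColumns v)
  sp = splitBy-sorted a (sortedColumns v) (sortedColumns-sorted v)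
  open SplitBy sp
  below : ∀ {x} → x ∈ map proj₂ low ++ map proj₂ high → x < suc (length v)
  below x∈ = s≤s (proj₂ (∈-γ⁻ v (subst (_ ∈_) (sym (γ≡split v sp)) x∈)))

γ-Modasc-avoids : ∀ {y} → Modasc y → ¬ FishburnPattern (γ y)
γ-Modasc-avoids mEmpty ()
γ-Modasc-avoids mOne (later ())
γ-Modasc-avoids (mStay {v} {a = a} mv _ _ _) =
  subst (λ u → ¬ FishburnPattern (γ (u ++ [ a ]))) (map-id v)
    (¬FishburnPattern-growth (id-admissible a) v (ModascInvariant.newValuesAscend (modasc-invariant mv))
      (γ-Modasc-avoids mv))
γ-Modasc-avoids (mJump {v} {a = a} mv _ _ _) =
  ¬FishburnPattern-growth (shift-admissible a) v (ModascInvariant.newValuesAscend (modasc-invariant mv))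
    (γ-Modasc-avoids mv)

γ-Modasc-Fishburn : ∀ {y} → Modasc y → Fishburn (γ y)
γ-Modasc-Fishburn {y} my = γ-IsPerm y , γ-Modasc-avoids my ∘ Violation⇒FishburnPattern (γ y)

-- Every Fishburn permutation is the image of a modified ascent sequence

Preimage : List ℕ → Set
Preimage π = Σ (List ℕ) λ y → Modasc y × γ y ≡ π

module _ (v : List ℕ) (ascents : AscentsReachNewValues v) (low′ high′ : List Column) (x E z F : ℕ)
         (S≡ : sortedColumns v ≡ (low′ ++ [ (x , E) ]) ++ (z , F) ∷ high′)
         (noJunction : ¬ Junction (map proj₂ (low′ ++ [ (x , E) ])) (map proj₂ ((z , F) ∷ high′))) where

  private
    sorted : Sorted ((low′ ++ [ (x , E) ]) ++ (z , F) ∷ high′)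
    sorted = subst Sorted S≡ (sortedColumns-sorted v)

    ∈-S : ∀ {p} → p ∈ (low′ ++ [ (x , E) ]) ++ (z , F) ∷ high′ → p ∈ sortedColumns v
    ∈-S = subst (_ ∈_) (sym S≡)

    before-last : ∀ {p} → p ∈ low′ → p ≺ (x , E)
    before-last = AllPairs-to-last low′ sorted

    preceding-below : ∀ i₀ y → E ≡ suc (suc i₀) → at v i₀ ≡ just y → y < x
    preceding-below i₀ y refl at-i₀
      with ∈-++⁻ (low′ ++ [ (x , E) ]) (subst (_ ∈_) S≡ (∈-sortedColumns⁺ v i₀ at-i₀))
    ... | inj₂ y∈high =
      ⊥-elim (noJunction (map proj₂ low′ , suc i₀ , map-++ proj₂ low′ _ , ∈-map⁺ proj₂ y∈high))
    ... | inj₁ y∈low with ∈-++⁻ low′ y∈low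
    ...   | inj₂ (here i₀+1≡) = ⊥-elim (<-irrefl (cong proj₂ i₀+1≡) (n<1+n _))
    ...   | inj₁ y∈low′ with Before⁻ y (suc i₀) x E (proj₁ (before-last y∈low′))
    ...     | inj₁ y<x = y<x
    ...     | inj₂ (_ , i₀+2≤i₀+1) = ⊥-elim (<-irrefl refl i₀+2≤i₀+1)

  -- With equal values, the column (z , F) of high holds an earlier occurrence of x, so the entry y
  -- preceding position E would make an ascent to an old value.
  cut-values-< : x < z
  cut-values-< with AllPairs-++-between (low′ ++ [ (x , E) ]) sorted (∈-++⁺ʳ low′ (here refl)) (here refl)
  ... | x,E≤z,F , x,E≢z,F with Before⁻ x E z F x,E≤z,F
  ...   | inj₁ x<z = x<z
  ...   | inj₂ (refl , F≤E) with ∈-sortedColumns⁻ v (∈-S (∈-++⁺ʳ _ (here refl)))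
                               | ∈-sortedColumns⁻ v (∈-S (∈-++⁺ˡ (∈-++⁺ʳ low′ (here refl))))
  ...     | iF , refl , at-iF | iE , refl , at-iE with m≤n⇒m<n∨m≡n F≤E
  ...       | inj₂ F≡E = ⊥-elim (x,E≢z,F (cong (x ,_) (sym F≡E)))
  ...       | inj₁ (s≤s (s≤s {n = i₀} iF≤i₀))
    with at-defined v i₀ (<-trans (n<1+n i₀) (at-<-length v (suc i₀) at-iE))
  ...         | y , at-i₀ = ⊥-elim (ascents i₀ x y at-i₀ at-iE (preceding-below i₀ y refl at-i₀) iF iF≤i₀ at-iF)

values-separated : ∀ v → AscentsReachNewValues v → ∀ low high → sortedColumns v ≡ low ++ high →
  ¬ Junction (map proj₂ low) (map proj₂ high) → ∀ {p q} → p ∈ low → q ∈ high → proj₁ p < proj₁ q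
values-separated v ascents low ((z , F) ∷ high′) S≡ noJunction {p} {q} p∈ q∈ with initLast low
... | low′ ∷ʳ′ (x , E) =
  ≤-<-trans p≤x (<-≤-trans (cut-values-< v ascents low′ high′ x E z F S≡ noJunction) (z≤ q∈))
  where
  sorted : Sorted ((low′ ++ [ (x , E) ]) ++ (z , F) ∷ high′)
  sorted = subst Sorted S≡ (sortedColumns-sorted v)
  p≤x : proj₁ p ≤ x
  p≤x with ∈-++⁻ low′ p∈
  ... | inj₁ p∈low′ = Before⇒≤ p (x , E) (proj₁ (AllPairs-to-last low′ sorted p∈low′))
  ... | inj₂ (here refl) = ≤-refl
  z≤ : ∀ {q} → q ∈ (z , F) ∷ high′ → z ≤ proj₁ q
  z≤ (here refl) = ≤-refl
  z≤ {q} (there q∈high′) with AllPairs-++⁻ʳ (low′ ++ [ (x , E) ]) sorted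
  ... | z,F≺ ∷ _ = Before⇒≤ (z , F) q (proj₁ (All.lookup z,F≺ q∈high′))

-- The appended entry 1 + max (values of low) is old or new, giving an mStay or an mJump step.
Modasc-extend : ∀ w b → Modasc (w ++ [ b ]) → ∀ low high → sortedColumns (w ++ [ b ]) ≡ low ++ high →
  ¬ Junction (map proj₂ low) (map proj₂ high) → Preimage (map proj₂ low ++ suc (length (w ++ [ b ])) ∷ map proj₂ high)
Modasc-extend w b mv low high S≡ noJunction = extend (a ≤? b)
  where
  v : List ℕ
  v = w ++ [ b ]
  a : ℕ
  a = suc (maxL (map proj₁ low))
  open ModascInvariant (modasc-invariant mv)
  value∈ : ∀ {p} → p ∈ low ++ high → proj₁ p ∈ v
  value∈ p∈ = sortedColumns-value-∈ v (subst (_ ∈_) (sym S≡) p∈)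
  a≤high : ∀ {q} → q ∈ high → a ≤ proj₁ q
  a≤high {q} q∈ with maxL-∈ (map proj₁ low)
  ... | inj₁ values≡[] =
    subst (λ vs → suc (maxL vs) ≤ proj₁ q) (sym values≡[]) (All.lookup (proj₁ cayley) (value∈ (∈-++⁺ʳ low q∈)))
  ... | inj₂ max∈ with ∈-map⁻ proj₁ max∈
  ...   | p , p∈ , max≡ = subst (λ m → suc m ≤ proj₁ q) (sym max≡)
                            (values-separated v ascentsReachNewValues low high S≡ noJunction p∈ q∈)
  split : SplitBy a (sortedColumns v)
  split = splitBy low high S≡ (λ p∈ → s≤s (≤-maxL _ (∈-map⁺ proj₁ p∈))) a≤high
  a≤2+asc : a ≤ 2 + asc v
  a≤2+asc = s≤s (≤-trans (maxL-≤ (map proj₁ low) value≤) (≤-reflexive (maxL≡1+asc-snoc (modasc-invariant mv))))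
    where
    value≤ : ∀ {x} → x ∈ map proj₁ low → x ≤ maxL v
    value≤ x∈ with ∈-map⁻ proj₁ x∈
    ... | p , p∈ , refl = ≤-maxL v (value∈ (∈-++⁺ˡ p∈))
  extend : Dec (a ≤ b) → Preimage (map proj₂ low ++ suc (length v) ∷ map proj₂ high)
  extend (yes a≤b) = v ++ [ a ] , mStay mv (w , refl) (s≤s z≤n) a≤b ,
    subst (λ u → γ (u ++ [ a ]) ≡ map proj₂ low ++ suc (length v) ∷ map proj₂ high) (map-id v)
      (γ-growth (id-admissible a) v split)
  extend (no a≰b) = bump a v ++ [ a ] , mJump mv (w , refl) (≰⇒> a≰b) a≤2+asc , γ-growth (shift-admissible a) v split

module _ (m : ℕ) (L R : List ℕ) (perm : IsPerm (L ++ suc m ∷ R)) (len : length (L ++ suc m ∷ R) ≡ suc m) where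

  private
    positive : All (1 ≤_) (L ++ suc m ∷ R)
    positive = proj₁ (proj₁ perm)
    covers : ∀ k → 1 ≤ k → k ≤ maxL (L ++ suc m ∷ R) → k ∈ L ++ suc m ∷ R
    covers = proj₂ (proj₁ perm)
    unique : Unique (L ++ suc m ∷ R)
    unique = proj₂ perm

    removed⊆ : L ++ R ⊆ L ++ suc m ∷ R
    removed⊆ = Sublist.++⁺ ⊆-refl (suc m ∷ʳ ⊆-refl)

    ≢max : ∀ (L : List ℕ) {x} → Unique (L ++ suc m ∷ R) → x ∈ L ++ R → x ≢ suc m
    ≢max [] (m∉ ∷ _) x∈ refl = All.lookup m∉ x∈ refl
    ≢max (l ∷ L) (l∉ ∷ _) (here refl) refl = All.lookup l∉ (∈-++⁺ʳ L (here refl)) refl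
    ≢max (l ∷ L) (_ ∷ u) (there x∈) = ≢max L u x∈

  length-remove-max : length (L ++ R) ≡ m
  length-remove-max = suc-injective (trans (sym (length-++-sucʳ L (suc m) R)) len)

  remaining-≤ : ∀ {x} → x ∈ L ++ R → x ≤ m
  remaining-≤ x∈ = s≤s⁻¹ (≤∧≢⇒< (subst (_ ≤_) (trans (maxL-perm _ perm) len) (≤-maxL _ (∈-++-insert L x∈)))
                                 (≢max L unique x∈))

  ¬FishburnPattern-remove-max : ¬ FishburnPattern (L ++ suc m ∷ R) → ¬ FishburnPattern (L ++ R)
  ¬FishburnPattern-remove-max avoids occurrence =
    avoids (FishburnPattern-insert L R (suc m) occurrence (s≤s ∘ remaining-≤ ∘ ∈-++⁺ˡ))

  ¬Junction-remove-max : ¬ FishburnPattern (L ++ suc m ∷ R) → ¬ Junction L R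
  ¬Junction-remove-max avoids junction =
    avoids (Junction⇒FishburnPattern L R (suc m) junction (s≤s ∘ remaining-≤ ∘ ∈-++⁺ˡ))

  IsPerm-remove-max : IsPerm (L ++ R)
  IsPerm-remove-max =
    (Sublist.All-resp-⊆ removed⊆ positive ,
     λ k 1≤k k≤ → let k≤m = ≤-trans k≤ (maxL-≤ (L ++ R) remaining-≤) in
       ∈-++-delete L (covers k 1≤k (≤-trans k≤m (subst (m ≤_) (sym (trans (maxL-perm _ perm) len)) (n≤1+n m))))
         (λ { refl → <-irrefl refl k≤m })) ,
    AllPairs-resp-⊆ unique removed⊆

insert-max : ∀ m L R → (∀ π → length π ≡ m → IsPerm π → ¬ FishburnPattern π → Preimage π) →
  IsPerm (L ++ suc m ∷ R) → length (L ++ suc m ∷ R) ≡ suc m → ¬ FishburnPattern (L ++ suc m ∷ R) →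
  Preimage (L ++ suc m ∷ R)
insert-max zero [] [] _ _ _ _ = 1 ∷ [] , mOne , refl
insert-max zero [] (_ ∷ _) _ _ () _
insert-max zero (x ∷ L) R _ perm len _ = ⊥-elim (0≢1+n (sym (length-remove-max 0 (x ∷ L) R perm len)))
insert-max (suc m) L R preimage perm len avoids
  with preimage (L ++ R) (length-remove-max (suc m) L R perm len) (IsPerm-remove-max (suc m) L R perm len)
                (¬FishburnPattern-remove-max (suc m) L R perm len avoids)
... | v , mv , γv≡ with initLast v
...   | [] = ⊥-elim (0≢1+n (trans (cong length γv≡) (length-remove-max (suc m) L R perm len)))
...   | w ∷ʳ′ b
  with map-++⁻ proj₂ (sortedColumns (w ++ [ b ])) L R (trans (sym (γ≡sortedColumns (w ++ [ b ]))) γv≡)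
...     | low , high , S≡ , refl , refl
  with Modasc-extend w b mv low high S≡ (¬Junction-remove-max (suc m) _ _ perm len avoids)
...       | y , my , γy≡ = y , my , trans γy≡ (cong (λ n → map proj₂ low ++ suc n ∷ map proj₂ high) length≡)
  where
  length≡ : length (w ++ [ b ]) ≡ suc m
  length≡ = trans (sym (γ-length (w ++ [ b ]))) (trans (cong length γv≡) (length-remove-max (suc m) _ _ perm len))

Fishburn⇒γ-Modasc : ∀ n π → length π ≡ n → IsPerm π → ¬ FishburnPattern π → Preimage π
Fishburn⇒γ-Modasc zero [] _ _ _ = [] , mEmpty , refl
Fishburn⇒γ-Modasc (suc m) π len perm avoids
  with ∈-∃++ (proj₂ (proj₁ perm) (suc m) (s≤s z≤n) (≤-reflexive (sym (trans (maxL-perm π perm) len))))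
... | L , R , refl = insert-max m L R (Fishburn⇒γ-Modasc m) perm len avoids

mainTheorem3 : (Ω : List ℕ → Set) → (∀ σ → Ω σ → IsPerm σ) →
    ∀ π → FishAvoid Ω π ⇔ (∃ λ y → ModascAvoid Ω y × γ y ≡ π)
mainTheorem3 Ω perms π = mk⇔ to from
  where
  to : FishAvoid Ω π → ∃ λ y → ModascAvoid Ω y × γ y ≡ π
  to ((perm , noViolation) , avoidsΩ)
    with Fishburn⇒γ-Modasc (length π) π refl perm (noViolation ∘ FishburnPattern⇒Violation)
  ... | y , my , refl = y , (my , avoidsClass) , refl
    where
    avoidsClass : ∀ z → InvClass Ω z → Avoids y z
    avoidsClass z (σ , σ∈Ω , _ , γz≡) y⊇z =
      avoidsΩ σ σ∈Ω (subst (Contains (γ y)) (trans γz≡ (γ-inv σ (perms σ σ∈Ω))) (Contains-γ y z y⊇z))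
  from : (∃ λ y → ModascAvoid Ω y × γ y ≡ π) → FishAvoid Ω π
  from (y , (my , avoidsClass) , refl) = γ-Modasc-Fishburn my , avoidsΩ
    where
    avoidsΩ : ∀ σ → Ω σ → Avoids (γ y) σ
    avoidsΩ σ σ∈Ω γy⊇σ with γ-Contains⁻ y σ (perms σ σ∈Ω) γy⊇σ
    ... | z , cayley , γz≡σ , y⊇z =
      avoidsClass z (σ , σ∈Ω , cayley , trans γz≡σ (sym (γ-inv σ (perms σ σ∈Ω)))) y⊇z
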